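{- For every nonnegative integer $n$, \[ L_0(n)-L_1(n)=\begin{cases}1 & \text{if } n \text{ is a triangular number},\\ 0 & \text{otherwise},\end{cases} \qquad L_2(n)-L_3(n)=\begin{cases}(-1)^n & \text{if } n \text{ is a triangular number},\\ 0 & \text{otherwise}.\end{cases} \]
   Context: A two-color partition of $n$ is a partition of $n$ in which each part is colored either blue or green; parts of the same size but different colors are regarded as different. Let $L(n)$ be the number of two-color partitions of $n$ in which all parts are distinct (i.e. no part of a given size appears twice in the same color) and odd parts may occur only in the blue color (so the green parts are distinct even numbers and the blue parts are distinct positive integers). Among the partitions counted by $L(n)$: $L_0(n)$ (resp. $L_1(n)$) is the number in which the number of blue even parts is even (resp. odd); $L_2(n)$ (resp. $L_3(n)$) is the number in which the number of blue parts is even (resp. odd). A triangular number is a number of the form $k(k+1)/2$ with $k\ge 0$ an integer. -}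

module Defs where

open import Data.Bool using (Bool; true; false; not; _∧_; if_then_else_)
open import Data.Nat public using (ℕ; zero; suc; _+_; _*_; _≡ᵇ_)
open import Data.List using (List; []; _∷_; map; length; filterᵇ; concatMap)
open import Data.Nat.ListAction using (sum)
open import Data.Vec using (Vec; []; _∷_)
open import Data.Product using (_×_; _,_; ∃)
open import Data.Integer using (ℤ; _-_) renaming (+_ to ⁺)
open import Relation.Binary.PropositionalEquality using (_≡_)

evenᵇ : ℕ → Bool
evenᵇ zero = true
evenᵇ (suc n) = not (evenᵇ n)

allBits : (n : ℕ) → List (Vec Bool n)
allBits zero = [] ∷ []
allBits (suc n) = concatMap (λ v → (true ∷ v) ∷ (false ∷ v) ∷ []) (allBits n)

-- the set of parts encoded by a bit vector: bit at position i (0-based)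
-- present means the part (offset + i + 1) is present
partsFrom : ℕ → {n : ℕ} → Vec Bool n → List ℕ
partsFrom k [] = []
partsFrom k (true ∷ v) = suc k ∷ partsFrom (suc k) v
partsFrom k (false ∷ v) = partsFrom (suc k) v

parts : {n : ℕ} → Vec Bool n → List ℕ
parts = partsFrom 0

allᵇ : (ℕ → Bool) → List ℕ → Bool
allᵇ p [] = true
allᵇ p (x ∷ xs) = p x ∧ allᵇ p xs

-- A two-colour partition counted by L(n): a pair (blue, green) of sets of
-- distinct positive integers (every part of a partition of n is ≤ n, so
-- subsets of {1,…,n} suffice), the green parts all even, total sum n.
isLPartition : (n : ℕ) → Vec Bool n × Vec Bool n → Bool
isLPartition n (b , g) = allᵇ evenᵇ (parts g) ∧ ((sum (parts b) + sum (parts g)) ≡ᵇ n)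

allPairs : (n : ℕ) → List (Vec Bool n × Vec Bool n)
allPairs n = concatMap (λ b → map (λ g → (b , g)) (allBits n)) (allBits n)

LPartitions : (n : ℕ) → List (Vec Bool n × Vec Bool n)
LPartitions n = filterᵇ (isLPartition n) (allPairs n)

blueEvenCount : {n : ℕ} → Vec Bool n × Vec Bool n → ℕ
blueEvenCount (b , g) = length (filterᵇ evenᵇ (parts b))

blueCount : {n : ℕ} → Vec Bool n × Vec Bool n → ℕ
blueCount (b , g) = length (parts b)

L₀ L₁ L₂ L₃ : ℕ → ℕ
L₀ n = length (filterᵇ (λ p → evenᵇ (blueEvenCount p)) (LPartitions n))
L₁ n = length (filterᵇ (λ p → not (evenᵇ (blueEvenCount p))) (LPartitions n))
L₂ n = length (filterᵇ (λ p → evenᵇ (blueCount p)) (LPartitions n))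
L₃ n = length (filterᵇ (λ p → not (evenᵇ (blueCount p))) (LPartitions n))

Triangular : ℕ → Set
Triangular n = ∃ λ k → 2 * n ≡ k * suc k

{-# OPTIONS --safe #-}
module Submission where

-- Weight a colouring by (−1)^(number of even blue parts). A part j then contributes the
-- factor 1 + q^j if j is odd and (1 − q^j)(1 + q^j) if j is even, so
--   Σₙ (L₀(n) − L₁(n)) qⁿ = ∏ₖ (1 + q^k) ∏ₖ (1 − q^2k) = (q;q)∞ (−q;q)∞².
-- That this is Σₖ q^(k(k+1)/2) is Gauss's identity, which we derive from the finite Jacobi
-- triple product at z = 1 with L = M = u + 1,
--   (−q;q)_L (−1;q)_M = Σ_c q^((c−u)(c−u−1)/2) [L+M, c]_q.
-- Multiplying by (q;q)_{u+1} turns every term into q^((c−u)(c−u−1)/2) modulo q^(u+1), and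
-- (−1;q)_{u+1} = 2 (−q;q)_u. Hence up to degree u the series (q;q)_{u+1} (−q;q)_{u+1} (−q;q)_u
-- is Σ_{k ≤ u} q^(k(k+1)/2). Finally all green parts are even, so the number of blue parts has
-- the parity of n plus the number of even blue parts, whence L₂ − L₃ = (−1)ⁿ (L₀ − L₁).

import Algebra.Properties.CommutativeSemigroup as CommSemigroupProperties
open import Data.Bool using (Bool; true; false; not; _∧_; if_then_else_)
open import Data.Bool.Properties using (∧-conicalˡ; ∧-conicalʳ; T-≡)
open import Data.Integer as ℤ using (ℤ; 0ℤ; 1ℤ; -1ℤ; _+_; _*_; _-_; _^_) renaming (+_ to ⁺)
import Data.Integer.Properties as ℤ
open import Data.Integer.Solver using (module +-*-Solver)
open import Data.List using (List; []; _∷_; _++_; length; filterᵇ; concatMap; map)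
open import Data.List.Properties using (++-assoc)
open import Data.List.Relation.Unary.All as All using (All; []; _∷_)
import Data.List.Relation.Unary.All.Properties as All
open import Data.Nat as ℕ using (ℕ; zero; suc; _≤_; _<_; _≤′_; z≤n; s≤s; _∸_; _≡ᵇ_)
import Data.Nat.Properties as ℕ
open import Data.Nat.ListAction using (sum)
open import Data.Product using (_×_; _,_; proj₁; proj₂; ∃)
open import Data.Sum using (inj₁; inj₂)
open import Data.Vec using (Vec; []; _∷_)
open import Function using (_∘_; _⇔_; mk⇔; Equivalence)
open import Function.Definitions using (Injective)
open import Relation.Binary using (Setoid)
open import Relation.Binary.Definitions using (tri<; tri≈; tri>)
open import Relation.Binary.PropositionalEquality
import Relation.Binary.Reasoning.Setoid as SetoidReasoning
open import Relation.Nullary using (¬_; contradiction)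

open import Defs
  using (evenᵇ; allᵇ; allBits; partsFrom; parts; isLPartition; allPairs; LPartitions;
         blueEvenCount; blueCount; L₀; L₁; L₂; L₃; Triangular)

open +-*-Solver using (solve; _:+_; _:-_; _:*_; _:=_; con)
module ℕ+ = CommSemigroupProperties ℕ.+-commutativeSemigroup
module ℤ+ = CommSemigroupProperties ℤ.+-commutativeSemigroup
module ℤ* = CommSemigroupProperties ℤ.*-commutativeSemigroup

Series : Set
Series = ℕ → ℤ

module ≗ = Setoid (ℕ →-setoid ℤ)
module ≗-Reasoning = SetoidReasoning (ℕ →-setoid ℤ)

variable
  A B : Set
  f f′ g g′ h : Series
  a b c d k m n r u N : ℕ

0ₛ : Series
0ₛ _ = 0ℤ

q^_ : ℕ → Series
(q^ d) n = if d ≡ᵇ n then 1ℤ else 0ℤ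

1ₛ : Series
1ₛ = q^ 0

infixl 6 _⊕_
_⊕_ : Series → Series → Series
(f ⊕ g) n = f n + g n

infixr 7 _·_
_·_ : ℤ → Series → Series
(c · f) n = c * f n

shift : ℕ → Series → Series
shift zero f = f
shift (suc k) f zero = 0ℤ
shift (suc k) f (suc n) = shift k f n

⊕-cong : f ≗ f′ → g ≗ g′ → f ⊕ g ≗ f′ ⊕ g′
⊕-cong p q n = cong₂ _+_ (p n) (q n)

⊕-congˡ : ∀ f → g ≗ g′ → f ⊕ g ≗ f ⊕ g′
⊕-congˡ f p n = cong (f n +_) (p n)

⊕-congʳ : ∀ g → f ≗ f′ → f ⊕ g ≗ f′ ⊕ g
⊕-congʳ g p n = cong (_+ g n) (p n)

⊕-identityʳ : ∀ f → f ⊕ 0ₛ ≗ f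
⊕-identityʳ f n = ℤ.+-identityʳ (f n)

⊕-comm : ∀ f g → f ⊕ g ≗ g ⊕ f
⊕-comm f g n = ℤ.+-comm (f n) (g n)

⊕-assoc : ∀ f g h → (f ⊕ g) ⊕ h ≗ f ⊕ (g ⊕ h)
⊕-assoc f g h n = ℤ.+-assoc (f n) (g n) (h n)

⊕-interchange : ∀ f g f′ g′ → (f ⊕ g) ⊕ (f′ ⊕ g′) ≗ (f ⊕ f′) ⊕ (g ⊕ g′)
⊕-interchange f g f′ g′ n = ℤ+.interchange (f n) (g n) (f′ n) (g′ n)

⊕-leftComm : ∀ f g h → f ⊕ (g ⊕ h) ≗ g ⊕ (f ⊕ h)
⊕-leftComm f g h n = ℤ+.x∙yz≈y∙xz (f n) (g n) (h n)

·-cong : ∀ c → f ≗ g → c · f ≗ c · g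
·-cong c f≗g n = cong (c *_) (f≗g n)

·-⊕ : ∀ c f g → c · (f ⊕ g) ≗ c · f ⊕ c · g
·-⊕ c f g n = ℤ.*-distribˡ-+ c (f n) (g n)

shift-cong : ∀ k → f ≗ g → shift k f ≗ shift k g
shift-cong zero p n = p n
shift-cong (suc k) p zero = refl
shift-cong (suc k) p (suc n) = shift-cong k p n

shift-⊕ : ∀ k f g → shift k (f ⊕ g) ≗ shift k f ⊕ shift k g
shift-⊕ zero f g n = refl
shift-⊕ (suc k) f g zero = refl
shift-⊕ (suc k) f g (suc n) = shift-⊕ k f g n

shift-· : ∀ k c f → shift k (c · f) ≗ c · shift k f
shift-· zero c f n = refl
shift-· (suc k) c f zero = sym (ℤ.*-zeroʳ c)
shift-· (suc k) c f (suc n) = shift-· k c f n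

shift-0ₛ : ∀ k → shift k 0ₛ ≗ 0ₛ
shift-0ₛ zero n = refl
shift-0ₛ (suc k) zero = refl
shift-0ₛ (suc k) (suc n) = shift-0ₛ k n

shift-+ : ∀ j k f → shift (j ℕ.+ k) f ≗ shift j (shift k f)
shift-+ zero k f n = refl
shift-+ (suc j) k f zero = refl
shift-+ (suc j) k f (suc n) = shift-+ j k f n

shift-shift-≡ : ∀ j k j′ k′ f → j ℕ.+ k ≡ j′ ℕ.+ k′ → shift j (shift k f) ≗ shift j′ (shift k′ f)
shift-shift-≡ j k j′ k′ f eq n = begin
  shift j (shift k f) n    ≡⟨ shift-+ j k f n ⟨
  shift (j ℕ.+ k) f n      ≡⟨ cong (λ e → shift e f n) eq ⟩
  shift (j′ ℕ.+ k′) f n    ≡⟨ shift-+ j′ k′ f n ⟩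
  shift j′ (shift k′ f) n  ∎
  where open ≡-Reasoning

shift-comm : ∀ j k f → shift j (shift k f) ≗ shift k (shift j f)
shift-comm j k f = shift-shift-≡ j k k j f (ℕ.+-comm j k)

shift-suc-comm : ∀ j k f → shift (suc j) (shift k f) ≗ shift (suc k) (shift j f)
shift-suc-comm j k f zero = refl
shift-suc-comm j k f (suc n) = shift-comm j k f n

shift-q^ : ∀ j d → shift j (q^ d) ≗ q^ (j ℕ.+ d)
shift-q^ zero d n = refl
shift-q^ (suc j) d zero = refl
shift-q^ (suc j) d (suc n) = shift-q^ j d n

shift-1ₛ : ∀ d → shift d 1ₛ ≗ q^ d
shift-1ₛ zero n = refl
shift-1ₛ (suc d) zero = refl
shift-1ₛ (suc d) (suc n) = shift-1ₛ d n

shift-below : ∀ k f → n < k → shift k f n ≡ 0ℤ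
shift-below {zero} (suc k) f _ = refl
shift-below {suc n} (suc k) f (s≤s n<k) = shift-below k f n<k

q^-coeff-≡ : ∀ d → (q^ d) d ≡ 1ℤ
q^-coeff-≡ zero = refl
q^-coeff-≡ (suc d) = q^-coeff-≡ d

q^-coeff-≢ : d ≢ n → (q^ d) n ≡ 0ℤ
q^-coeff-≢ {zero} {zero} 0≢0 = contradiction refl 0≢0
q^-coeff-≢ {zero} {suc n} _ = refl
q^-coeff-≢ {suc d} {zero} _ = refl
q^-coeff-≢ {suc d} {suc n} d+1≢n+1 = q^-coeff-≢ (d+1≢n+1 ∘ cong suc)

infix 4 _≈[_]_
_≈[_]_ : Series → ℕ → Series → Set
f ≈[ r ] g = ∀ i → i ≤ r → f i ≡ g i

≗⇒≈ : f ≗ g → f ≈[ r ] g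
≗⇒≈ p i _ = p i

≈-trans : f ≈[ r ] g → g ≈[ r ] h → f ≈[ r ] h
≈-trans p q i i≤r = trans (p i i≤r) (q i i≤r)

≈-weaken : r ≤ m → f ≈[ m ] g → f ≈[ r ] g
≈-weaken r≤m p i i≤r = p i (ℕ.≤-trans i≤r r≤m)

shift-≈ : ∀ k → f ≈[ r ] g → shift k f ≈[ k ℕ.+ r ] shift k g
shift-≈ zero p = p
shift-≈ (suc k) p zero _ = refl
shift-≈ (suc k) p (suc i) (s≤s i≤k+r) = shift-≈ k p i i≤k+r

-- (c , k) stands for the binomial 1 + c q^k. Every product in the argument is a product of
-- such binomials, so series are only ever multiplied by them and no Cauchy product is needed.
Factor : Set
Factor = ℤ × ℕ

times : Factor → Series → Series
times (c , k) f = f ⊕ c · shift k f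

times* : List Factor → Series → Series
times* [] f = f
times* (x ∷ xs) f = times x (times* xs f)

times-cong : ∀ x → f ≗ g → times x f ≗ times x g
times-cong (c , k) p = ⊕-cong p (λ n → cong (c *_) (shift-cong k p n))

times-⊕ : ∀ x f g → times x (f ⊕ g) ≗ times x f ⊕ times x g
times-⊕ (c , k) f g n rewrite shift-⊕ k f g n =
  solve 5 (λ c a b x y → (a :+ b) :+ c :* (x :+ y) := (a :+ c :* x) :+ (b :+ c :* y))
    refl c (f n) (g n) (shift k f n) (shift k g n)

times-0ₛ : ∀ x → times x 0ₛ ≗ 0ₛ
times-0ₛ (c , k) n rewrite shift-0ₛ k n | ℤ.*-zeroʳ c = refl

times-shift : ∀ x j f → times x (shift j f) ≗ shift j (times x f)
times-shift (c , k) j f n = begin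
  shift j f n + c * shift k (shift j f) n  ≡⟨ cong (λ z → shift j f n + c * z) (shift-comm j k f n) ⟨
  shift j f n + c * shift j (shift k f) n  ≡⟨ cong (shift j f n +_) (shift-· j c (shift k f) n) ⟨
  shift j f n + shift j (c · shift k f) n  ≡⟨ shift-⊕ j f (c · shift k f) n ⟨
  shift j (times (c , k) f) n              ∎
  where open ≡-Reasoning

times-comm : ∀ x y f → times x (times y f) ≗ times y (times x f)
times-comm (c , k) (d , j) f n = begin
  times (d , j) f n + c * shift k (times (d , j) f) n
    ≡⟨ cong (λ z → times (d , j) f n + c * z) (times-shift (d , j) k f n) ⟨
  (f n + d * shift j f n) + c * (shift k f n + d * shift j (shift k f) n)
    ≡⟨ cong (λ z → (f n + d * shift j f n) + c * (shift k f n + d * z)) (shift-comm j k f n) ⟩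
  (f n + d * shift j f n) + c * (shift k f n + d * shift k (shift j f) n)
    ≡⟨ solve 6 (λ c d a x y z → (a :+ d :* x) :+ c :* (y :+ d :* z) := (a :+ c :* y) :+ d :* (x :+ c :* z))
         refl c d (f n) (shift j f n) (shift k f n) (shift k (shift j f) n) ⟩
  (f n + c * shift k f n) + d * (shift j f n + c * shift k (shift j f) n)
    ≡⟨ cong (λ z → times (c , k) f n + d * z) (times-shift (c , k) j f n) ⟩
  times (c , k) f n + d * shift j (times (c , k) f) n
    ∎
  where open ≡-Reasoning

times*-cong : ∀ xs → f ≗ g → times* xs f ≗ times* xs g
times*-cong [] p = p
times*-cong (x ∷ xs) p = times-cong x (times*-cong xs p)

times*-⊕ : ∀ xs f g → times* xs (f ⊕ g) ≗ times* xs f ⊕ times* xs g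
times*-⊕ [] f g = ≗.refl
times*-⊕ (x ∷ xs) f g = ≗.trans (times-cong x (times*-⊕ xs f g)) (times-⊕ x (times* xs f) (times* xs g))

times*-0ₛ : ∀ xs → times* xs 0ₛ ≗ 0ₛ
times*-0ₛ [] = ≗.refl
times*-0ₛ (x ∷ xs) = ≗.trans (times-cong x (times*-0ₛ xs)) (times-0ₛ x)

times*-shift : ∀ xs j f → times* xs (shift j f) ≗ shift j (times* xs f)
times*-shift [] j f = ≗.refl
times*-shift (x ∷ xs) j f = ≗.trans (times-cong x (times*-shift xs j f)) (times-shift x j (times* xs f))

times*-++ : ∀ xs ys f → times* (xs ++ ys) f ≗ times* xs (times* ys f)
times*-++ [] ys f = ≗.refl
times*-++ (x ∷ xs) ys f = times-cong x (times*-++ xs ys f)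

times*-times : ∀ xs x f → times* xs (times x f) ≗ times x (times* xs f)
times*-times [] x f = ≗.refl
times*-times (y ∷ xs) x f = ≗.trans (times-cong y (times*-times xs x f)) (times-comm y x (times* xs f))

times*-comm : ∀ xs ys f → times* xs (times* ys f) ≗ times* ys (times* xs f)
times*-comm xs [] f = ≗.refl
times*-comm xs (y ∷ ys) f = ≗.trans (times*-times xs y (times* ys f)) (times-cong y (times*-comm xs ys f))

times-≈ : ∀ x → f ≈[ r ] g → times x f ≈[ r ] times x g
times-≈ {r = r} (c , k) p i i≤r =
  cong₂ (λ y z → y + c * z) (p i i≤r) (≈-weaken (ℕ.m≤n+m r k) (shift-≈ k p) i i≤r)

times*-≈ : ∀ xs → f ≈[ r ] g → times* xs f ≈[ r ] times* xs g
times*-≈ [] p = p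
times*-≈ (x ∷ xs) p = times-≈ x (times*-≈ xs p)

times-≈-id : ∀ c → r < k → times (c , k) f ≈[ r ] f
times-≈-id {k = k} {f = f} c r<k i i≤r = begin
  f i + c * shift k f i  ≡⟨ cong (λ z → f i + c * z) (shift-below k f (ℕ.≤-<-trans i≤r r<k)) ⟩
  f i + c * 0ℤ           ≡⟨ cong (f i +_) (ℤ.*-zeroʳ c) ⟩
  f i + 0ℤ               ≡⟨ ℤ.+-identityʳ (f i) ⟩
  f i                    ∎
  where open ≡-Reasoning

times*-≈-id : ∀ {xs} → All (λ x → r < proj₂ x) xs → times* xs f ≈[ r ] f
times*-≈-id [] = ≗⇒≈ ≗.refl
times*-≈-id {xs = (c , k) ∷ xs} (r<k ∷ rs) = ≈-trans (times-≈-id c r<k) (times*-≈-id rs)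

⊕-shift : ∀ k f → f ⊕ shift k f ≗ times (1ℤ , k) f
⊕-shift k f n = cong (f n +_) (sym (ℤ.*-identityˡ (shift k f n)))

times-minus-telescope : ∀ k j f → times (-1ℤ , k) f ⊕ shift k (times (-1ℤ , j) f) ≗ times (-1ℤ , j ℕ.+ k) f
times-minus-telescope k j f n = begin
  (f n + -1ℤ * shift k f n) + shift k (times (-1ℤ , j) f) n
    ≡⟨ cong ((f n + -1ℤ * shift k f n) +_) (times-shift (-1ℤ , j) k f n) ⟨
  (f n + -1ℤ * shift k f n) + (shift k f n + -1ℤ * shift j (shift k f) n)
    ≡⟨ solve 3 (λ x y z → (x :+ con -1ℤ :* y) :+ (y :+ con -1ℤ :* z) := x :+ con -1ℤ :* z)
         refl (f n) (shift k f n) (shift j (shift k f) n) ⟩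
  f n + -1ℤ * shift j (shift k f) n
    ≡⟨ cong (λ z → f n + -1ℤ * z) (shift-+ j k f n) ⟨
  f n + -1ℤ * shift (j ℕ.+ k) f n
    ∎
  where open ≡-Reasoning

times-minus-double : ∀ {j} k f → j ≡ k ℕ.+ k → times (-1ℤ , j) f ≗ times (-1ℤ , k) (times (1ℤ , k) f)
times-minus-double k f refl n = begin
  f n + -1ℤ * shift (k ℕ.+ k) f n
    ≡⟨ solve 3 (λ a x y → a :+ con -1ℤ :* y := (a :+ con 1ℤ :* x) :+ con -1ℤ :* (x :+ con 1ℤ :* y))
         refl (f n) (shift k f n) (shift (k ℕ.+ k) f n) ⟩
  (f n + 1ℤ * shift k f n) + -1ℤ * (shift k f n + 1ℤ * shift (k ℕ.+ k) f n)
    ≡⟨ cong (λ z → (f n + 1ℤ * shift k f n) + -1ℤ * (shift k f n + 1ℤ * z)) (shift-+ k k f n) ⟩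
  (f n + 1ℤ * shift k f n) + -1ℤ * (shift k f n + 1ℤ * shift k (shift k f) n)
    ≡⟨ cong (λ z → (f n + 1ℤ * shift k f n) + -1ℤ * z) (times-shift (1ℤ , k) k f n) ⟩
  (f n + 1ℤ * shift k f n) + -1ℤ * shift k (times (1ℤ , k) f) n
    ∎
  where open ≡-Reasoning

-- factorsAbove -1ℤ b a, factorsUpTo -1ℤ a, factorsUpTo 1ℤ a and factorsBelow 1ℤ M are the
-- q-Pochhammer symbols (q^(b+1);q)_a, (q;q)_a, (−q;q)_a and (−1;q)_M.
factorsAbove : ℤ → ℕ → ℕ → List Factor
factorsAbove c b zero = []
factorsAbove c b (suc a) = (c , b ℕ.+ suc a) ∷ factorsAbove c b a

factorsUpTo : ℤ → ℕ → List Factor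
factorsUpTo c = factorsAbove c 0

factorsBelow : ℤ → ℕ → List Factor
factorsBelow c zero = []
factorsBelow c (suc k) = (c , k) ∷ factorsBelow c k

factorsAbove-suc : ∀ c b a → factorsAbove c b (suc a) ≡ factorsAbove c (suc b) a ++ (c , suc b) ∷ []
factorsAbove-suc c b zero = cong (λ k → (c , k) ∷ []) (ℕ.+-comm b 1)
factorsAbove-suc c b (suc a) = cong₂ _∷_ (cong (c ,_) (ℕ.+-suc b (suc a))) (factorsAbove-suc c b a)

times*-factorsAbove-suc : ∀ c b a f →
  times* (factorsAbove c b (suc a)) f ≗ times (c , suc b) (times* (factorsAbove c (suc b) a) f)
times*-factorsAbove-suc c b a f = begin
  times* (factorsAbove c b (suc a)) f                       ≡⟨ cong (λ xs → times* xs f) (factorsAbove-suc c b a) ⟩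
  times* (factorsAbove c (suc b) a ++ (c , suc b) ∷ []) f   ≈⟨ times*-++ (factorsAbove c (suc b) a) _ f ⟩
  times* (factorsAbove c (suc b) a) (times (c , suc b) f)   ≈⟨ times*-times (factorsAbove c (suc b) a) (c , suc b) f ⟩
  times (c , suc b) (times* (factorsAbove c (suc b) a) f)   ∎
  where open ≗-Reasoning

factorsAbove-above : ∀ c b a → All (λ x → b < proj₂ x) (factorsAbove c b a)
factorsAbove-above c b zero = []
factorsAbove-above c b (suc a) = ℕ.m<m+n b (s≤s z≤n) ∷ factorsAbove-above c b a

factorsUpTo-≈ : ∀ (c : ℤ) → a ≤ N → times* (factorsUpTo c N) f ≈[ a ] times* (factorsUpTo c a) f
factorsUpTo-≈ {f = f} c a≤N = dropHigh (ℕ.≤⇒≤′ a≤N)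
  where
  dropHigh : ∀ {a N} → a ≤′ N → times* (factorsUpTo c N) f ≈[ a ] times* (factorsUpTo c a) f
  dropHigh ℕ.≤′-refl = ≗⇒≈ ≗.refl
  dropHigh (ℕ.≤′-step a≤′N) = ≈-trans (times-≈-id c (s≤s (ℕ.≤′⇒≤ a≤′N))) (dropHigh a≤′N)

factorsBelow-suc : ∀ c M → factorsBelow c (suc M) ≡ factorsUpTo c M ++ (c , 0) ∷ []
factorsBelow-suc c zero = refl
factorsBelow-suc c (suc M) = cong ((c , suc M) ∷_) (factorsBelow-suc c M)

times*-factorsBelow-one : ∀ M f →
  times* (factorsBelow 1ℤ (suc M)) f ≗ times* (factorsUpTo 1ℤ M) f ⊕ times* (factorsUpTo 1ℤ M) f
times*-factorsBelow-one M f = begin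
  times* (factorsBelow 1ℤ (suc M)) f              ≡⟨ cong (λ xs → times* xs f) (factorsBelow-suc 1ℤ M) ⟩
  times* (factorsUpTo 1ℤ M ++ (1ℤ , 0) ∷ []) f    ≈⟨ times*-++ (factorsUpTo 1ℤ M) _ f ⟩
  times* (factorsUpTo 1ℤ M) (f ⊕ 1ℤ · f)          ≈⟨ times*-cong (factorsUpTo 1ℤ M) (λ n → cong (f n +_) (ℤ.*-identityˡ (f n))) ⟩
  times* (factorsUpTo 1ℤ M) (f ⊕ f)               ≈⟨ times*-⊕ (factorsUpTo 1ℤ M) f f ⟩
  times* (factorsUpTo 1ℤ M) f ⊕ times* (factorsUpTo 1ℤ M) f ∎
  where open ≗-Reasoning

∑ : ℕ → (ℕ → Series) → Series
∑ zero F = 0ₛ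
∑ (suc K) F = ∑ K F ⊕ F K

∑-coeff-cong : ∀ K {F G : ℕ → Series} → (∀ c → c < K → F c n ≡ G c n) → ∑ K F n ≡ ∑ K G n
∑-coeff-cong zero p = refl
∑-coeff-cong (suc K) p = cong₂ _+_ (∑-coeff-cong K (λ c c<K → p c (ℕ.m<n⇒m<1+n c<K))) (p K ℕ.≤-refl)

∑-⊕ : ∀ K (F G : ℕ → Series) → ∑ K (λ c → F c ⊕ G c) ≗ ∑ K F ⊕ ∑ K G
∑-⊕ zero F G n = sym (ℤ.+-identityʳ 0ℤ)
∑-⊕ (suc K) F G n rewrite ∑-⊕ K F G n =
  ℤ+.interchange (∑ K F n) (∑ K G n) (F K n) (G K n)

∑-shift : ∀ K j (F : ℕ → Series) → ∑ K (λ c → shift j (F c)) ≗ shift j (∑ K F)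
∑-shift zero j F = ≗.sym (shift-0ₛ j)
∑-shift (suc K) j F = ≗.trans (⊕-congʳ (shift j (F K)) (∑-shift K j F)) (≗.sym (shift-⊕ j (∑ K F) (F K)))

∑-first : ∀ K (F : ℕ → Series) → ∑ (suc K) F ≗ F 0 ⊕ ∑ K (F ∘ suc)
∑-first zero F n = trans (ℤ.+-identityˡ (F 0 n)) (sym (ℤ.+-identityʳ (F 0 n)))
∑-first (suc K) F n rewrite ∑-first K F n = ℤ.+-assoc (F 0 n) _ _

∑-peel : ∀ K (P : ℕ → Series) → P (suc K) ≗ 0ₛ → P 0 ⊕ ∑ (suc K) (P ∘ suc) ≗ ∑ (suc K) P
∑-peel K P P[1+K]≗0 = begin
  P 0 ⊕ ∑ (suc K) (P ∘ suc)  ≈⟨ ∑-first (suc K) P ⟨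
  ∑ (suc K) P ⊕ P (suc K)    ≈⟨ ⊕-congˡ (∑ (suc K) P) P[1+K]≗0 ⟩
  ∑ (suc K) P ⊕ 0ₛ           ≈⟨ ⊕-identityʳ (∑ (suc K) P) ⟩
  ∑ (suc K) P                ∎
  where open ≗-Reasoning

∑-+ : ∀ a b (F : ℕ → Series) → ∑ (a ℕ.+ b) F ≗ ∑ a F ⊕ ∑ b (λ k → F (a ℕ.+ k))
∑-+ a zero F n rewrite ℕ.+-identityʳ a = sym (ℤ.+-identityʳ _)
∑-+ a (suc b) F n rewrite ℕ.+-suc a b | ∑-+ a b F n = ℤ.+-assoc (∑ a F n) _ _

∑-reverse : ∀ u (F : ℕ → Series) → ∑ (suc u) (λ c → F (u ∸ c)) ≗ ∑ (suc u) F
∑-reverse zero F = ≗.refl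
∑-reverse (suc u) F = begin
  ∑ (suc (suc u)) (λ c → F (suc u ∸ c))   ≈⟨ ∑-first (suc u) (λ c → F (suc u ∸ c)) ⟩
  F (suc u) ⊕ ∑ (suc u) (λ c → F (u ∸ c))  ≈⟨ ⊕-congˡ (F (suc u)) (∑-reverse u F) ⟩
  F (suc u) ⊕ ∑ (suc u) F                  ≈⟨ ⊕-comm (F (suc u)) (∑ (suc u) F) ⟩
  ∑ (suc (suc u)) F                         ∎
  where open ≗-Reasoning

times*-∑ : ∀ xs K (F : ℕ → Series) → times* xs (∑ K F) ≗ ∑ K (λ c → times* xs (F c))
times*-∑ xs zero F = times*-0ₛ xs
times*-∑ xs (suc K) F = ≗.trans (times*-⊕ xs (∑ K F) (F K)) (⊕-congʳ (times* xs (F K)) (times*-∑ xs K F))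

-- The Gaussian binomial coefficient [a+b, a]_q.
qBinomial : ℕ → ℕ → Series
qBinomial zero b = 1ₛ
qBinomial (suc a) zero = 1ₛ
qBinomial (suc a) (suc b) = qBinomial a (suc b) ⊕ shift (suc a) (qBinomial (suc a) b)

qBinomial-zeroʳ : ∀ a → qBinomial a 0 ≗ 1ₛ
qBinomial-zeroʳ zero = ≗.refl
qBinomial-zeroʳ (suc a) = ≗.refl

qBinomial-pascal′ : ∀ a b → qBinomial (suc a) (suc b) ≗ shift (suc b) (qBinomial a (suc b)) ⊕ qBinomial (suc a) b
qBinomial-pascal′ zero zero = ⊕-comm 1ₛ (shift 1 1ₛ)
qBinomial-pascal′ (suc a) zero = begin
  qBinomial (suc a) 1 ⊕ shift (suc (suc a)) 1ₛ
    ≈⟨ ⊕-congʳ (shift (suc (suc a)) 1ₛ) (qBinomial-pascal′ a zero) ⟩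
  (shift 1 (qBinomial a 1) ⊕ 1ₛ) ⊕ shift (suc (suc a)) 1ₛ
    ≈⟨ ⊕-assoc (shift 1 (qBinomial a 1)) 1ₛ _ ⟩
  shift 1 (qBinomial a 1) ⊕ (1ₛ ⊕ shift (suc (suc a)) 1ₛ)
    ≈⟨ ⊕-congˡ (shift 1 (qBinomial a 1)) (⊕-comm 1ₛ _) ⟩
  shift 1 (qBinomial a 1) ⊕ (shift (suc (suc a)) 1ₛ ⊕ 1ₛ)
    ≈⟨ ⊕-congˡ (shift 1 (qBinomial a 1)) (⊕-congʳ 1ₛ (shift-+ 1 (suc a) 1ₛ)) ⟩
  shift 1 (qBinomial a 1) ⊕ (shift 1 (shift (suc a) 1ₛ) ⊕ 1ₛ)
    ≈⟨ ⊕-assoc (shift 1 (qBinomial a 1)) _ 1ₛ ⟨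
  (shift 1 (qBinomial a 1) ⊕ shift 1 (shift (suc a) 1ₛ)) ⊕ 1ₛ
    ≈⟨ ⊕-congʳ 1ₛ (shift-⊕ 1 (qBinomial a 1) (shift (suc a) 1ₛ)) ⟨
  shift 1 (qBinomial (suc a) 1) ⊕ 1ₛ
    ∎
  where open ≗-Reasoning
qBinomial-pascal′ zero (suc b) = begin
  1ₛ ⊕ shift 1 (qBinomial 1 (suc b))
    ≈⟨ ⊕-congˡ 1ₛ (shift-cong 1 (qBinomial-pascal′ zero b)) ⟩
  1ₛ ⊕ shift 1 (shift (suc b) 1ₛ ⊕ qBinomial 1 b)
    ≈⟨ ⊕-congˡ 1ₛ (shift-⊕ 1 (shift (suc b) 1ₛ) (qBinomial 1 b)) ⟩
  1ₛ ⊕ (shift 1 (shift (suc b) 1ₛ) ⊕ shift 1 (qBinomial 1 b))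
    ≈⟨ ⊕-congˡ 1ₛ (⊕-congʳ (shift 1 (qBinomial 1 b)) (shift-+ 1 (suc b) 1ₛ)) ⟨
  1ₛ ⊕ (shift (suc (suc b)) 1ₛ ⊕ shift 1 (qBinomial 1 b))
    ≈⟨ ⊕-leftComm 1ₛ (shift (suc (suc b)) 1ₛ) (shift 1 (qBinomial 1 b)) ⟩
  shift (suc (suc b)) 1ₛ ⊕ (1ₛ ⊕ shift 1 (qBinomial 1 b))
    ∎
  where open ≗-Reasoning
qBinomial-pascal′ (suc a) (suc b) = begin
  qBinomial (suc a) (suc (suc b)) ⊕ shift (suc (suc a)) (qBinomial (suc (suc a)) (suc b))
    ≈⟨ ⊕-cong (qBinomial-pascal′ a (suc b)) (shift-cong (suc (suc a)) (qBinomial-pascal′ (suc a) b)) ⟩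
  (shift (suc (suc b)) X ⊕ Y) ⊕ shift (suc (suc a)) (shift (suc b) Y ⊕ Z)
    ≈⟨ ⊕-congˡ (shift (suc (suc b)) X ⊕ Y) (shift-⊕ (suc (suc a)) (shift (suc b) Y) Z) ⟩
  (shift (suc (suc b)) X ⊕ Y) ⊕ (shift (suc (suc a)) (shift (suc b) Y) ⊕ shift (suc (suc a)) Z)
    ≈⟨ ⊕-congˡ (shift (suc (suc b)) X ⊕ Y) (⊕-congʳ (shift (suc (suc a)) Z) (shift-suc-comm (suc a) (suc b) Y)) ⟩
  (shift (suc (suc b)) X ⊕ Y) ⊕ (shift (suc (suc b)) (shift (suc a) Y) ⊕ shift (suc (suc a)) Z)
    ≈⟨ ⊕-interchange (shift (suc (suc b)) X) Y _ _ ⟩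
  (shift (suc (suc b)) X ⊕ shift (suc (suc b)) (shift (suc a) Y)) ⊕ (Y ⊕ shift (suc (suc a)) Z)
    ≈⟨ ⊕-congʳ (Y ⊕ shift (suc (suc a)) Z) (shift-⊕ (suc (suc b)) X (shift (suc a) Y)) ⟨
  shift (suc (suc b)) (X ⊕ shift (suc a) Y) ⊕ (Y ⊕ shift (suc (suc a)) Z)
    ∎
  where
  open ≗-Reasoning
  X = qBinomial a (suc (suc b))
  Y = qBinomial (suc a) (suc b)
  Z = qBinomial (suc (suc a)) b

qBinomial-sym : ∀ a b → qBinomial a b ≗ qBinomial b a
qBinomial-sym zero zero = ≗.refl
qBinomial-sym zero (suc b) = ≗.refl
qBinomial-sym (suc a) zero = ≗.refl
qBinomial-sym (suc a) (suc b) = begin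
  qBinomial a (suc b) ⊕ shift (suc a) (qBinomial (suc a) b)
    ≈⟨ ⊕-cong (qBinomial-sym a (suc b)) (shift-cong (suc a) (qBinomial-sym (suc a) b)) ⟩
  qBinomial (suc b) a ⊕ shift (suc a) (qBinomial b (suc a))
    ≈⟨ ⊕-comm (qBinomial (suc b) a) _ ⟩
  shift (suc a) (qBinomial b (suc a)) ⊕ qBinomial (suc b) a
    ≈⟨ qBinomial-pascal′ b a ⟨
  qBinomial (suc b) (suc a)
    ∎
  where open ≗-Reasoning

qFactorial-qBinomial : ∀ a b → times* (factorsUpTo -1ℤ a) (qBinomial a b) ≗ times* (factorsAbove -1ℤ b a) 1ₛ
qFactorial-qBinomial zero b = ≗.refl
qFactorial-qBinomial (suc a) zero = ≗.refl
qFactorial-qBinomial (suc a) (suc b) = begin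
  times* Φ (qBinomial a (suc b) ⊕ shift (suc a) (qBinomial (suc a) b))
    ≈⟨ times*-⊕ Φ _ _ ⟩
  times* Φ (qBinomial a (suc b)) ⊕ times* Φ (shift (suc a) (qBinomial (suc a) b))
    ≈⟨ ⊕-cong (times-cong (-1ℤ , suc a) (qFactorial-qBinomial a (suc b))) (times*-shift Φ (suc a) _) ⟩
  times (-1ℤ , suc a) X ⊕ shift (suc a) (times* Φ (qBinomial (suc a) b))
    ≈⟨ ⊕-congˡ (times (-1ℤ , suc a) X) (shift-cong (suc a) (qFactorial-qBinomial (suc a) b)) ⟩
  times (-1ℤ , suc a) X ⊕ shift (suc a) (times* (factorsAbove -1ℤ b (suc a)) 1ₛ)
    ≈⟨ ⊕-congˡ (times (-1ℤ , suc a) X) (shift-cong (suc a) (times*-factorsAbove-suc -1ℤ b a 1ₛ)) ⟩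
  times (-1ℤ , suc a) X ⊕ shift (suc a) (times (-1ℤ , suc b) X)
    ≈⟨ times-minus-telescope (suc a) (suc b) X ⟩
  times (-1ℤ , suc b ℕ.+ suc a) X
    ∎
  where
  open ≗-Reasoning
  Φ = factorsUpTo -1ℤ (suc a)
  X = times* (factorsAbove -1ℤ (suc b) a) 1ₛ

qFactorial-qBinomial-≈ : a ≤ N → r ≤ a → r ≤ b → times* (factorsUpTo -1ℤ N) (qBinomial a b) ≈[ r ] 1ₛ
qFactorial-qBinomial-≈ {a} {b = b} a≤N r≤a r≤b =
  ≈-trans (≈-weaken r≤a (factorsUpTo-≈ -1ℤ a≤N))
  (≈-trans (≗⇒≈ (qFactorial-qBinomial a b))
           (≈-weaken r≤b (times*-≈-id (factorsAbove-above -1ℤ b a))))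

tri : ℕ → ℕ
tri zero = 0
tri (suc k) = suc k ℕ.+ tri k

tri-≥ : ∀ k → k ≤ tri k
tri-≥ zero = z≤n
tri-≥ (suc k) = ℕ.m≤m+n (suc k) (tri k)

tri-double : ∀ k → 2 ℕ.* tri k ≡ k ℕ.* suc k
tri-double zero = refl
tri-double (suc k) = begin
  2 ℕ.* (suc k ℕ.+ tri k)          ≡⟨ ℕ.*-distribˡ-+ 2 (suc k) (tri k) ⟩
  2 ℕ.* suc k ℕ.+ 2 ℕ.* tri k      ≡⟨ cong (2 ℕ.* suc k ℕ.+_) (tri-double k) ⟩
  2 ℕ.* suc k ℕ.+ k ℕ.* suc k      ≡⟨ ℕ.*-distribʳ-+ (suc k) 2 k ⟨
  suc (suc k) ℕ.* suc k            ≡⟨ ℕ.*-comm (suc (suc k)) (suc k) ⟩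
  suc k ℕ.* suc (suc k)            ∎
  where open ≡-Reasoning

tri-strictlyIncreasing : a < b → tri a < tri b
tri-strictlyIncreasing {zero} {suc b} _ = s≤s z≤n
tri-strictlyIncreasing {suc a} {suc b} (s≤s a<b) = ℕ.+-mono-≤-< (s≤s (ℕ.<⇒≤ a<b)) (tri-strictlyIncreasing a<b)

tri-injective : Injective _≡_ _≡_ tri
tri-injective {a} {b} tri[a]≡tri[b] with ℕ.<-cmp a b
... | tri< a<b _ _ = contradiction tri[a]≡tri[b] (ℕ.<⇒≢ (tri-strictlyIncreasing a<b))
... | tri≈ _ a≡b _ = a≡b
... | tri> _ _ b<a = contradiction (sym tri[a]≡tri[b]) (ℕ.<⇒≢ (tri-strictlyIncreasing b<a))

Triangular⇔tri : Triangular n ⇔ ∃ λ k → tri k ≡ n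
Triangular⇔tri = mk⇔ (λ (k , 2n≡k[k+1]) → k , ℕ.*-cancelˡ-≡ _ _ 2 (trans (tri-double k) (sym 2n≡k[k+1])))
                     (λ (k , tri[k]≡n) → k , trans (cong (2 ℕ.*_) (sym tri[k]≡n)) (tri-double k))

coeff-∑-q^-miss : ∀ K (e : ℕ → ℕ) → (∀ k → k < K → e k ≢ n) → ∑ K (q^_ ∘ e) n ≡ 0ℤ
coeff-∑-q^-miss zero e _ = refl
coeff-∑-q^-miss (suc K) e miss =
  cong₂ _+_ (coeff-∑-q^-miss K e (λ k k<K → miss k (ℕ.m<n⇒m<1+n k<K))) (q^-coeff-≢ (miss K ℕ.≤-refl))

coeff-∑-q^-hit : ∀ K (e : ℕ → ℕ) → Injective _≡_ _≡_ e → k < K → e k ≡ n → ∑ K (q^_ ∘ e) n ≡ 1ℤ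
coeff-∑-q^-hit {k} (suc K) e e-inj k<1+K refl with ℕ.m≤n⇒m<n∨m≡n (ℕ.≤-pred k<1+K)
... | inj₁ k<K = cong₂ _+_ (coeff-∑-q^-hit K e e-inj k<K refl)
                           (q^-coeff-≢ (λ e[K]≡e[k] → ℕ.<-irrefl (e-inj (sym e[K]≡e[k])) k<K))
... | inj₂ refl = cong₂ _+_ (coeff-∑-q^-miss K e (λ j j<K e[j]≡e[K] → ℕ.<-irrefl (e-inj e[j]≡e[K]) j<K))
                            (q^-coeff-≡ (e K))

coeff-∑-q^-tri : ∀ K → n < K →
  (Triangular n → ∑ K (q^_ ∘ tri) n ≡ 1ℤ) × (¬ Triangular n → ∑ K (q^_ ∘ tri) n ≡ 0ℤ)
coeff-∑-q^-tri {n} K n<K = hit , miss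
  where
  hit : Triangular n → ∑ K (q^_ ∘ tri) n ≡ 1ℤ
  hit Δn with Equivalence.to Triangular⇔tri Δn
  ... | k , tri[k]≡n = coeff-∑-q^-hit K tri tri-injective k<K tri[k]≡n
    where k<K = ℕ.≤-<-trans (ℕ.≤-trans (tri-≥ k) (ℕ.≤-reflexive tri[k]≡n)) n<K
  miss : ¬ Triangular n → ∑ K (q^_ ∘ tri) n ≡ 0ℤ
  miss ¬Δn = coeff-∑-q^-miss K tri (λ k _ tri[k]≡n → ¬Δn (Equivalence.from Triangular⇔tri (k , tri[k]≡n)))

-- (a − u)(a − u − 1)/2, computed without subtraction.
jacobiExp : ℕ → ℕ → ℕ
jacobiExp u zero = tri u
jacobiExp zero (suc a) = tri a
jacobiExp (suc u) (suc a) = jacobiExp u a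

jacobiExp-suc : ∀ u a → jacobiExp u a ℕ.+ a ≡ jacobiExp u (suc a) ℕ.+ u
jacobiExp-suc zero zero = refl
jacobiExp-suc zero (suc a) = trans (ℕ.+-comm (tri a) (suc a)) (sym (ℕ.+-identityʳ _))
jacobiExp-suc (suc u) zero = trans (ℕ.+-identityʳ _) (ℕ.+-comm (suc u) (tri u))
jacobiExp-suc (suc u) (suc a) = begin
  jacobiExp u a ℕ.+ suc a          ≡⟨ ℕ.+-suc (jacobiExp u a) a ⟩
  suc (jacobiExp u a ℕ.+ a)        ≡⟨ cong suc (jacobiExp-suc u a) ⟩
  suc (jacobiExp u (suc a) ℕ.+ u)  ≡⟨ ℕ.+-suc (jacobiExp u (suc a)) u ⟨
  jacobiExp u (suc a) ℕ.+ suc u    ∎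
  where open ≡-Reasoning

jacobiExp-suc′ : ∀ u a → suc u ℕ.+ jacobiExp u (suc a) ≡ jacobiExp u a ℕ.+ suc a
jacobiExp-suc′ u a = begin
  suc u ℕ.+ jacobiExp u (suc a)  ≡⟨ ℕ.+-comm (suc u) _ ⟩
  jacobiExp u (suc a) ℕ.+ suc u  ≡⟨ ℕ.+-suc (jacobiExp u (suc a)) u ⟩
  suc (jacobiExp u (suc a) ℕ.+ u) ≡⟨ cong suc (jacobiExp-suc u a) ⟨
  suc (jacobiExp u a ℕ.+ a)      ≡⟨ ℕ.+-suc (jacobiExp u a) a ⟨
  jacobiExp u a ℕ.+ suc a        ∎
  where open ≡-Reasoning

jacobiExp-pascal : ∀ L u a b → a ℕ.+ b ≡ L ℕ.+ u → L ℕ.+ jacobiExp u a ≡ jacobiExp u (suc a) ℕ.+ b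
jacobiExp-pascal L u a b a+b≡L+u = ℕ.+-cancelʳ-≡ a _ _ (begin
  (L ℕ.+ e) ℕ.+ a      ≡⟨ ℕ.+-assoc L e a ⟩
  L ℕ.+ (e ℕ.+ a)      ≡⟨ cong (L ℕ.+_) (jacobiExp-suc u a) ⟩
  L ℕ.+ (e′ ℕ.+ u)     ≡⟨ ℕ+.x∙yz≈y∙xz L e′ u ⟩
  e′ ℕ.+ (L ℕ.+ u)     ≡⟨ cong (e′ ℕ.+_) a+b≡L+u ⟨
  e′ ℕ.+ (a ℕ.+ b)     ≡⟨ ℕ+.x∙yz≈xz∙y e′ a b ⟩
  (e′ ℕ.+ b) ℕ.+ a     ∎)
  where
  open ≡-Reasoning
  e = jacobiExp u a
  e′ = jacobiExp u (suc a)

jacobiExp-below : a ≤ u → jacobiExp u a ≡ tri (u ∸ a)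
jacobiExp-below {zero} _ = refl
jacobiExp-below {suc a} {suc u} (s≤s a≤u) = jacobiExp-below a≤u

jacobiExp-above : ∀ u k → jacobiExp u (suc u ℕ.+ k) ≡ tri k
jacobiExp-above zero k = refl
jacobiExp-above (suc u) k = jacobiExp-above u k

jacobiExp-below-bound : c ≤ u → u ≤ jacobiExp u c ℕ.+ c
jacobiExp-below-bound {c} {u} c≤u = begin
  u                    ≡⟨ ℕ.m∸n+n≡m c≤u ⟨
  (u ∸ c) ℕ.+ c        ≤⟨ ℕ.+-monoˡ-≤ c (tri-≥ (u ∸ c)) ⟩
  tri (u ∸ c) ℕ.+ c    ≡⟨ cong (ℕ._+ c) (jacobiExp-below c≤u) ⟨
  jacobiExp u c ℕ.+ c  ∎
  where open ℕ.≤-Reasoning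

jacobiExp-above-bound : k ℕ.+ b ≡ suc u → u ≤ jacobiExp u (suc u ℕ.+ k) ℕ.+ b
jacobiExp-above-bound {k} {b} {u} k+b≡u+1 = begin
  u                                 ≤⟨ ℕ.n≤1+n u ⟩
  suc u                             ≡⟨ k+b≡u+1 ⟨
  k ℕ.+ b                           ≤⟨ ℕ.+-monoˡ-≤ b (tri-≥ k) ⟩
  tri k ℕ.+ b                       ≡⟨ cong (ℕ._+ b) (jacobiExp-above u k) ⟨
  jacobiExp u (suc u ℕ.+ k) ℕ.+ b   ∎
  where open ℕ.≤-Reasoning

-- tripleCoeff L M c is the coefficient of z^c in ∏_{k=1}^{L} (1 + z q^k) ∏_{k<M} (z + q^k).
tripleCoeff₀ : ℕ → ℕ → Series
tripleCoeff₀ zero zero = 1ₛ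
tripleCoeff₀ zero (suc c) = 0ₛ
tripleCoeff₀ (suc M) zero = shift M (tripleCoeff₀ M zero)
tripleCoeff₀ (suc M) (suc c) = tripleCoeff₀ M c ⊕ shift M (tripleCoeff₀ M (suc c))

tripleCoeff : ℕ → ℕ → ℕ → Series
tripleCoeff zero M c = tripleCoeff₀ M c
tripleCoeff (suc L) M zero = tripleCoeff L M zero
tripleCoeff (suc L) M (suc c) = tripleCoeff L M (suc c) ⊕ shift (suc L) (tripleCoeff L M c)

tripleCoeff₀-vanish : ∀ M c → M < c → tripleCoeff₀ M c ≗ 0ₛ
tripleCoeff₀-vanish zero (suc c) _ = ≗.refl
tripleCoeff₀-vanish (suc M) (suc c) (s≤s M<c) n
  rewrite tripleCoeff₀-vanish M c M<c n
        | shift-cong M (tripleCoeff₀-vanish M (suc c) (ℕ.m<n⇒m<1+n M<c)) n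
        | shift-0ₛ M n = refl

tripleCoeff-vanish : ∀ L M c → L ℕ.+ M < c → tripleCoeff L M c ≗ 0ₛ
tripleCoeff-vanish zero M c L+M<c = tripleCoeff₀-vanish M c L+M<c
tripleCoeff-vanish (suc L) M (suc c) (s≤s L+M<c) n
  rewrite tripleCoeff-vanish L M (suc c) (ℕ.m<n⇒m<1+n L+M<c) n
        | shift-cong (suc L) (tripleCoeff-vanish L M c L+M<c) n
        | shift-0ₛ (suc L) n = refl

∑-tripleCoeff₀ : ∀ M → ∑ (suc M) (tripleCoeff₀ M) ≗ times* (factorsBelow 1ℤ M) 1ₛ
∑-tripleCoeff₀ zero n = ℤ.+-identityˡ (1ₛ n)
∑-tripleCoeff₀ (suc M) = begin
  ∑ (suc (suc M)) (tripleCoeff₀ (suc M))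
    ≈⟨ ∑-first (suc M) (tripleCoeff₀ (suc M)) ⟩
  shift M (P 0) ⊕ ∑ (suc M) (λ c → P c ⊕ shift M (P (suc c)))
    ≈⟨ ⊕-congˡ (shift M (P 0)) (∑-⊕ (suc M) P (λ c → shift M (P (suc c)))) ⟩
  shift M (P 0) ⊕ (S ⊕ ∑ (suc M) (λ c → shift M (P (suc c))))
    ≈⟨ ⊕-leftComm (shift M (P 0)) S _ ⟩
  S ⊕ (shift M (P 0) ⊕ ∑ (suc M) (λ c → shift M (P (suc c))))
    ≈⟨ ⊕-congˡ S (⊕-congˡ (shift M (P 0)) (∑-shift (suc M) M (P ∘ suc))) ⟩
  S ⊕ (shift M (P 0) ⊕ shift M (∑ (suc M) (P ∘ suc)))
    ≈⟨ ⊕-congˡ S (shift-⊕ M (P 0) _) ⟨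
  S ⊕ shift M (P 0 ⊕ ∑ (suc M) (P ∘ suc))
    ≈⟨ ⊕-congˡ S (shift-cong M (∑-peel M P (tripleCoeff₀-vanish M (suc M) ℕ.≤-refl))) ⟩
  S ⊕ shift M S
    ≈⟨ ⊕-shift M S ⟩
  times (1ℤ , M) S
    ≈⟨ times-cong (1ℤ , M) (∑-tripleCoeff₀ M) ⟩
  times* (factorsBelow 1ℤ (suc M)) 1ₛ
    ∎
  where
  open ≗-Reasoning
  P = tripleCoeff₀ M
  S = ∑ (suc M) P

∑-tripleCoeff : ∀ L M → ∑ (suc (L ℕ.+ M)) (tripleCoeff L M) ≗ times* (factorsUpTo 1ℤ L) (times* (factorsBelow 1ℤ M) 1ₛ)
∑-tripleCoeff zero M = ∑-tripleCoeff₀ M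
∑-tripleCoeff (suc L) M = begin
  ∑ (suc (suc K)) (tripleCoeff (suc L) M)
    ≈⟨ ∑-first (suc K) (tripleCoeff (suc L) M) ⟩
  P 0 ⊕ ∑ (suc K) (λ c → P (suc c) ⊕ shift (suc L) (P c))
    ≈⟨ ⊕-congˡ (P 0) (∑-⊕ (suc K) (P ∘ suc) (λ c → shift (suc L) (P c))) ⟩
  P 0 ⊕ (∑ (suc K) (P ∘ suc) ⊕ ∑ (suc K) (λ c → shift (suc L) (P c)))
    ≈⟨ ⊕-assoc (P 0) _ _ ⟨
  (P 0 ⊕ ∑ (suc K) (P ∘ suc)) ⊕ ∑ (suc K) (λ c → shift (suc L) (P c))
    ≈⟨ ⊕-cong (∑-peel K P (tripleCoeff-vanish L M (suc K) ℕ.≤-refl)) (∑-shift (suc K) (suc L) P) ⟩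
  S ⊕ shift (suc L) S
    ≈⟨ ⊕-shift (suc L) S ⟩
  times (1ℤ , suc L) S
    ≈⟨ times-cong (1ℤ , suc L) (∑-tripleCoeff L M) ⟩
  times* (factorsUpTo 1ℤ (suc L)) (times* (factorsBelow 1ℤ M) 1ₛ)
    ∎
  where
  open ≗-Reasoning
  K = L ℕ.+ M
  P = tripleCoeff L M
  S = ∑ (suc K) P

tripleCoeff₀-qBinomial : ∀ u a b → a ℕ.+ b ≡ suc u →
  tripleCoeff₀ (suc u) a ≗ shift (jacobiExp u a) (qBinomial a b)
tripleCoeff₀-qBinomial zero zero .1 refl = ≗.refl
tripleCoeff₀-qBinomial zero (suc zero) .0 refl = ⊕-identityʳ 1ₛ
tripleCoeff₀-qBinomial (suc u) zero .(suc (suc u)) refl = begin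
  shift (suc u) (tripleCoeff₀ (suc u) 0)  ≈⟨ shift-cong (suc u) (tripleCoeff₀-qBinomial u 0 (suc u) refl) ⟩
  shift (suc u) (shift (tri u) 1ₛ)        ≈⟨ shift-+ (suc u) (tri u) 1ₛ ⟨
  shift (tri (suc u)) 1ₛ                  ∎
  where open ≗-Reasoning
tripleCoeff₀-qBinomial (suc u) (suc a) zero a+1+0≡u+2 = begin
  tripleCoeff₀ (suc u) a ⊕ shift (suc u) (tripleCoeff₀ (suc u) (suc a))
    ≈⟨ ⊕-congˡ (tripleCoeff₀ (suc u) a) (shift-cong (suc u) (tripleCoeff₀-vanish (suc u) (suc a) (s≤s u+1≤a))) ⟩
  tripleCoeff₀ (suc u) a ⊕ shift (suc u) 0ₛ
    ≈⟨ ⊕-congˡ (tripleCoeff₀ (suc u) a) (shift-0ₛ (suc u)) ⟩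
  tripleCoeff₀ (suc u) a ⊕ 0ₛ
    ≈⟨ ⊕-identityʳ (tripleCoeff₀ (suc u) a) ⟩
  tripleCoeff₀ (suc u) a
    ≈⟨ tripleCoeff₀-qBinomial u a 0 a+0≡u+1 ⟩
  shift (jacobiExp u a) (qBinomial a 0)
    ≈⟨ shift-cong (jacobiExp u a) (qBinomial-zeroʳ a) ⟩
  shift (jacobiExp u a) 1ₛ
    ∎
  where
  open ≗-Reasoning
  a+0≡u+1 = ℕ.suc-injective a+1+0≡u+2
  u+1≤a = ℕ.≤-reflexive (trans (sym a+0≡u+1) (ℕ.+-identityʳ a))
tripleCoeff₀-qBinomial (suc u) (suc a) (suc b) a+b+2≡u+2 = begin
  tripleCoeff₀ (suc u) a ⊕ shift (suc u) (tripleCoeff₀ (suc u) (suc a))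
    ≈⟨ ⊕-cong (tripleCoeff₀-qBinomial u a (suc b) a+b+1≡u+1)
              (shift-cong (suc u) (tripleCoeff₀-qBinomial u (suc a) b (trans (sym (ℕ.+-suc a b)) a+b+1≡u+1))) ⟩
  shift e (qBinomial a (suc b)) ⊕ shift (suc u) (shift e′ (qBinomial (suc a) b))
    ≈⟨ ⊕-congˡ (shift e (qBinomial a (suc b))) (shift-shift-≡ (suc u) e′ e (suc a) (qBinomial (suc a) b) (jacobiExp-suc′ u a)) ⟩
  shift e (qBinomial a (suc b)) ⊕ shift e (shift (suc a) (qBinomial (suc a) b))
    ≈⟨ shift-⊕ e (qBinomial a (suc b)) _ ⟨
  shift e (qBinomial (suc a) (suc b))
    ∎
  where
  open ≗-Reasoning
  e = jacobiExp u a
  e′ = jacobiExp u (suc a)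
  a+b+1≡u+1 = ℕ.suc-injective a+b+2≡u+2

tripleCoeff-qBinomial : ∀ L u a b → a ℕ.+ b ≡ L ℕ.+ suc u →
  tripleCoeff L (suc u) a ≗ shift (jacobiExp u a) (qBinomial a b)
tripleCoeff-qBinomial zero u a b a+b≡u+1 = tripleCoeff₀-qBinomial u a b a+b≡u+1
tripleCoeff-qBinomial (suc L) u zero (suc b) b+1≡L+u+2 = tripleCoeff-qBinomial L u zero b (ℕ.suc-injective b+1≡L+u+2)
tripleCoeff-qBinomial (suc L) u (suc a) zero a+1+0≡L+u+2 = begin
  tripleCoeff L (suc u) (suc a) ⊕ shift (suc L) (tripleCoeff L (suc u) a)
    ≈⟨ ⊕-congʳ (shift (suc L) (tripleCoeff L (suc u) a)) (tripleCoeff-vanish L (suc u) (suc a) (s≤s L+u+1≤a)) ⟩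
  0ₛ ⊕ shift (suc L) (tripleCoeff L (suc u) a)
    ≈⟨ (λ n → ℤ.+-identityˡ _) ⟩
  shift (suc L) (tripleCoeff L (suc u) a)
    ≈⟨ shift-cong (suc L) (tripleCoeff-qBinomial L u a 0 a+0≡L+u+1) ⟩
  shift (suc L) (shift (jacobiExp u a) (qBinomial a 0))
    ≈⟨ shift-cong (suc L) (shift-cong (jacobiExp u a) (qBinomial-zeroʳ a)) ⟩
  shift (suc L) (shift (jacobiExp u a) 1ₛ)
    ≈⟨ shift-shift-≡ (suc L) (jacobiExp u a) (jacobiExp u (suc a)) 0 1ₛ (jacobiExp-pascal (suc L) u a 0 (trans a+0≡L+u+1 (ℕ.+-suc L u))) ⟩
  shift (jacobiExp u (suc a)) 1ₛ
    ∎
  where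
  open ≗-Reasoning
  a+0≡L+u+1 = ℕ.suc-injective a+1+0≡L+u+2
  L+u+1≤a = ℕ.≤-reflexive (trans (sym a+0≡L+u+1) (ℕ.+-identityʳ a))
tripleCoeff-qBinomial (suc L) u (suc a) (suc b) a+b+2≡L+u+2 = begin
  tripleCoeff L (suc u) (suc a) ⊕ shift (suc L) (tripleCoeff L (suc u) a)
    ≈⟨ ⊕-cong (tripleCoeff-qBinomial L u (suc a) b (trans (sym (ℕ.+-suc a b)) a+b+1≡L+u+1))
              (shift-cong (suc L) (tripleCoeff-qBinomial L u a (suc b) a+b+1≡L+u+1)) ⟩
  shift e′ Z ⊕ shift (suc L) (shift e Y)
    ≈⟨ ⊕-congˡ (shift e′ Z) (shift-shift-≡ (suc L) e e′ (suc b) Y (jacobiExp-pascal (suc L) u a (suc b) (trans a+b+1≡L+u+1 (ℕ.+-suc L u)))) ⟩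
  shift e′ Z ⊕ shift e′ (shift (suc b) Y)
    ≈⟨ shift-⊕ e′ Z (shift (suc b) Y) ⟨
  shift e′ (Z ⊕ shift (suc b) Y)
    ≈⟨ shift-cong e′ (⊕-comm Z (shift (suc b) Y)) ⟩
  shift e′ (shift (suc b) Y ⊕ Z)
    ≈⟨ shift-cong e′ (qBinomial-pascal′ a b) ⟨
  shift e′ (qBinomial (suc a) (suc b))
    ∎
  where
  open ≗-Reasoning
  e = jacobiExp u a
  e′ = jacobiExp u (suc a)
  Y = qBinomial a (suc b)
  Z = qBinomial (suc a) b
  a+b+1≡L+u+1 = ℕ.suc-injective a+b+2≡L+u+2

qFactorial-shift-qBinomial-coeff : ∀ e → a ≤ N → r ≤ a → r ≤ b → n ≤ e ℕ.+ r →
  times* (factorsUpTo -1ℤ N) (shift e (qBinomial a b)) n ≡ (q^ e) n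
qFactorial-shift-qBinomial-coeff {a} {N} {b = b} {n} e a≤N r≤a r≤b n≤e+r = begin
  times* (factorsUpTo -1ℤ N) (shift e (qBinomial a b)) n  ≡⟨ times*-shift (factorsUpTo -1ℤ N) e (qBinomial a b) n ⟩
  shift e (times* (factorsUpTo -1ℤ N) (qBinomial a b)) n  ≡⟨ shift-≈ e (qFactorial-qBinomial-≈ a≤N r≤a r≤b) n n≤e+r ⟩
  shift e 1ₛ n                                             ≡⟨ shift-1ₛ e n ⟩
  (q^ e) n                                                 ∎
  where open ≡-Reasoning

qFactorial-tripleCoeff-below : n ≤ u → c ≤ u →
  times* (factorsUpTo -1ℤ (suc u)) (tripleCoeff (suc u) (suc u) c) n ≡ (q^ tri (u ∸ c)) n
qFactorial-tripleCoeff-below {n} {u} {c} n≤u c≤u = begin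
  times* Φ (tripleCoeff (suc u) (suc u) c) n
    ≡⟨ times*-cong Φ (tripleCoeff-qBinomial (suc u) u c b₀ c+b₀≡2u+2) n ⟩
  times* Φ (shift (jacobiExp u c) (qBinomial c b₀)) n
    ≡⟨ qFactorial-shift-qBinomial-coeff (jacobiExp u c) (ℕ.m≤n⇒m≤1+n c≤u) ℕ.≤-refl c≤b₀
         (ℕ.≤-trans n≤u (jacobiExp-below-bound c≤u)) ⟩
  (q^ jacobiExp u c) n
    ≡⟨ cong (λ e → (q^ e) n) (jacobiExp-below c≤u) ⟩
  (q^ tri (u ∸ c)) n
    ∎
  where
  open ≡-Reasoning
  Φ = factorsUpTo -1ℤ (suc u)
  b₀ = suc (u ∸ c) ℕ.+ suc u
  c+b₀≡2u+2 : c ℕ.+ b₀ ≡ suc u ℕ.+ suc u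
  c+b₀≡2u+2 = trans (sym (ℕ.+-assoc c (suc (u ∸ c)) (suc u)))
                   (cong (ℕ._+ suc u) (trans (ℕ.+-suc c (u ∸ c)) (cong suc (ℕ.m+[n∸m]≡n c≤u))))
  c≤b₀ = ℕ.≤-trans (ℕ.m≤n⇒m≤1+n c≤u) (ℕ.m≤n+m (suc u) (suc (u ∸ c)))

qFactorial-tripleCoeff-above : n ≤ u → k ≤ suc u →
  times* (factorsUpTo -1ℤ (suc u)) (tripleCoeff (suc u) (suc u) (suc u ℕ.+ k)) n ≡ (q^ tri k) n
qFactorial-tripleCoeff-above {n} {u} {k} n≤u k≤u+1 = begin
  times* Φ (tripleCoeff (suc u) (suc u) c₀) n
    ≡⟨ times*-cong Φ (tripleCoeff-qBinomial (suc u) u c₀ b₀ c₀+b₀≡2u+2) n ⟩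
  times* Φ (shift (jacobiExp u c₀) (qBinomial c₀ b₀)) n
    ≡⟨ times*-cong Φ (shift-cong (jacobiExp u c₀) (qBinomial-sym c₀ b₀)) n ⟩
  times* Φ (shift (jacobiExp u c₀) (qBinomial b₀ c₀)) n
    ≡⟨ qFactorial-shift-qBinomial-coeff (jacobiExp u c₀) (ℕ.m∸n≤m (suc u) k) ℕ.≤-refl b₀≤c₀
         (ℕ.≤-trans n≤u (jacobiExp-above-bound (ℕ.m+[n∸m]≡n k≤u+1))) ⟩
  (q^ jacobiExp u c₀) n
    ≡⟨ cong (λ e → (q^ e) n) (jacobiExp-above u k) ⟩
  (q^ tri k) n
    ∎
  where
  open ≡-Reasoning
  Φ = factorsUpTo -1ℤ (suc u)
  c₀ = suc u ℕ.+ k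
  b₀ = suc u ∸ k
  c₀+b₀≡2u+2 : c₀ ℕ.+ b₀ ≡ suc u ℕ.+ suc u
  c₀+b₀≡2u+2 = trans (ℕ.+-assoc (suc u) k b₀) (cong (suc u ℕ.+_) (ℕ.m+[n∸m]≡n k≤u+1))
  b₀≤c₀ = ℕ.≤-trans (ℕ.m∸n≤m (suc u) k) (ℕ.m≤m+n (suc u) k)

+-double-injective : ∀ x y → x + x ≡ y + y → x ≡ y
+-double-injective x y x+x≡y+y = ℤ.*-cancelˡ-≡ (⁺ 2) x y (trans (twice x) (trans x+x≡y+y (sym (twice y))))
  where
  twice : ∀ z → ⁺ 2 * z ≡ z + z
  twice z = trans (ℤ.*-distribʳ-+ z 1ℤ 1ℤ) (cong₂ _+_ (ℤ.*-identityˡ z) (ℤ.*-identityˡ z))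

gaussProduct : ℕ → Series
gaussProduct u = times* (factorsUpTo -1ℤ (suc u)) (times* (factorsUpTo 1ℤ (suc u)) (times* (factorsUpTo 1ℤ u) 1ₛ))

gaussProduct-double : n ≤ u →
  gaussProduct u n + gaussProduct u n ≡ ∑ (suc u) (q^_ ∘ tri) n + ∑ (suc (suc u)) (q^_ ∘ tri) n
gaussProduct-double {n} {u} n≤u = begin
  gaussProduct u n + gaussProduct u n
    ≡⟨ times*-⊕ Φ (times* P Pu) (times* P Pu) n ⟨
  times* Φ (times* P Pu ⊕ times* P Pu) n
    ≡⟨ times*-cong Φ (times*-⊕ P Pu Pu) n ⟨
  times* Φ (times* P (Pu ⊕ Pu)) n
    ≡⟨ times*-cong Φ (times*-cong P (times*-factorsBelow-one u 1ₛ)) n ⟨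
  times* Φ (times* P (times* (factorsBelow 1ℤ M) 1ₛ)) n
    ≡⟨ times*-cong Φ (∑-tripleCoeff M M) n ⟨
  times* Φ (∑ (suc (M ℕ.+ M)) (tripleCoeff M M)) n
    ≡⟨ times*-∑ Φ (suc (M ℕ.+ M)) (tripleCoeff M M) n ⟩
  ∑ (suc (M ℕ.+ M)) T n
    ≡⟨ cong (λ K → ∑ K T n) (ℕ.+-suc M M) ⟨
  ∑ (M ℕ.+ suc M) T n
    ≡⟨ ∑-+ M (suc M) T n ⟩
  ∑ M T n + ∑ (suc M) (λ k → T (M ℕ.+ k)) n
    ≡⟨ cong₂ _+_ (∑-coeff-cong M (λ c c<M → qFactorial-tripleCoeff-below n≤u (ℕ.≤-pred c<M)))
                 (∑-coeff-cong (suc M) (λ k k<M+1 → qFactorial-tripleCoeff-above n≤u (ℕ.≤-pred k<M+1))) ⟩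
  ∑ M (λ c → q^ tri (u ∸ c)) n + ∑ (suc M) (q^_ ∘ tri) n
    ≡⟨ cong (_+ ∑ (suc M) (q^_ ∘ tri) n) (∑-reverse u (q^_ ∘ tri) n) ⟩
  ∑ M (q^_ ∘ tri) n + ∑ (suc M) (q^_ ∘ tri) n
    ∎
  where
  open ≡-Reasoning
  M = suc u
  Φ = factorsUpTo -1ℤ M
  P = factorsUpTo 1ℤ M
  Pu = times* (factorsUpTo 1ℤ u) 1ₛ
  T = λ c → times* Φ (tripleCoeff M M c)

gaussProduct-coeff : n ≤ u → (Triangular n → gaussProduct u n ≡ 1ℤ) × (¬ Triangular n → gaussProduct u n ≡ 0ℤ)
gaussProduct-coeff {n} {u} n≤u =
    (λ Δn → +-double-injective _ _ (trans (gaussProduct-double n≤u) (cong₂ _+_ (proj₁ below Δn) (proj₁ above Δn))))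
  , (λ ¬Δn → +-double-injective _ _ (trans (gaussProduct-double n≤u) (cong₂ _+_ (proj₂ below ¬Δn) (proj₂ above ¬Δn))))
  where
  below = coeff-∑-q^-tri (suc u) (s≤s n≤u)
  above = coeff-∑-q^-tri (suc (suc u)) (s≤s (ℕ.m≤n⇒m≤1+n n≤u))

blueSign : ℕ → ℤ
blueSign j = if evenᵇ j then -1ℤ else 1ℤ

greenFactors : ℕ → List Factor
greenFactors j = if evenᵇ j then (1ℤ , j) ∷ [] else []

partFactors : ℕ → List Factor
partFactors j = (blueSign j , j) ∷ greenFactors j

partFactorsFrom : ℕ → ℕ → List Factor
partFactorsFrom k zero = []
partFactorsFrom k (suc m) = partFactors (suc k) ++ partFactorsFrom (suc k) m

partFactorsFrom-+ : ∀ k a b → partFactorsFrom k (a ℕ.+ b) ≡ partFactorsFrom k a ++ partFactorsFrom (k ℕ.+ a) b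
partFactorsFrom-+ k zero b = cong (λ j → partFactorsFrom j b) (sym (ℕ.+-identityʳ k))
partFactorsFrom-+ k (suc a) b = begin
  partFactors (suc k) ++ partFactorsFrom (suc k) (a ℕ.+ b)
    ≡⟨ cong (partFactors (suc k) ++_) (partFactorsFrom-+ (suc k) a b) ⟩
  partFactors (suc k) ++ (partFactorsFrom (suc k) a ++ partFactorsFrom (suc k ℕ.+ a) b)
    ≡⟨ ++-assoc (partFactors (suc k)) (partFactorsFrom (suc k) a) _ ⟨
  (partFactors (suc k) ++ partFactorsFrom (suc k) a) ++ partFactorsFrom (suc k ℕ.+ a) b
    ≡⟨ cong (λ j → (partFactors (suc k) ++ partFactorsFrom (suc k) a) ++ partFactorsFrom j b) (ℕ.+-suc k a) ⟨
  (partFactors (suc k) ++ partFactorsFrom (suc k) a) ++ partFactorsFrom (k ℕ.+ suc a) b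
    ∎
  where open ≡-Reasoning

partFactors-above : ∀ {k} j → k < j → All (λ x → k < proj₂ x) (partFactors j)
partFactors-above j k<j with evenᵇ j
... | true = k<j ∷ k<j ∷ []
... | false = k<j ∷ []

partFactorsFrom-above : ∀ k m → All (λ x → k < proj₂ x) (partFactorsFrom k m)
partFactorsFrom-above k zero = []
partFactorsFrom-above k (suc m) = All.++⁺ (partFactors-above (suc k) (ℕ.n<1+n k))
  (All.map (ℕ.<-trans (ℕ.n<1+n k)) (partFactorsFrom-above (suc k) m))

evenᵇ-double : ∀ M → evenᵇ (M ℕ.+ M) ≡ true
evenᵇ-double zero = refl
evenᵇ-double (suc M) rewrite ℕ.+-suc M M | evenᵇ-double M = refl

times*-partFactorsFrom-double : ∀ M f →
  times* (partFactorsFrom 0 (M ℕ.+ M)) f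
    ≗ times* (factorsUpTo 1ℤ (M ℕ.+ M)) (times* (factorsUpTo -1ℤ M) (times* (factorsUpTo 1ℤ M) f))
times*-partFactorsFrom-double zero f = ≗.refl
times*-partFactorsFrom-double (suc M) f rewrite ℕ.+-suc M M = begin
  times* (partFactorsFrom 0 (suc (suc K))) f
    ≡⟨ cong (λ xs → times* xs f) split ⟩
  times* (partFactorsFrom 0 K ++ odd⁺ ∷ (-1ℤ , suc (suc K)) ∷ even⁺ ∷ []) f
    ≈⟨ times*-++ (partFactorsFrom 0 K) _ f ⟩
  times* (partFactorsFrom 0 K) (times odd⁺ (times (-1ℤ , suc (suc K)) (times even⁺ f)))
    ≈⟨ times*-cong (partFactorsFrom 0 K) (times-cong odd⁺ (times-minus-double (suc M) (times even⁺ f) (cong suc (sym (ℕ.+-suc M M))))) ⟩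
  times* (partFactorsFrom 0 K) (times* (odd⁺ ∷ half⁻ ∷ half⁺ ∷ even⁺ ∷ []) f)
    ≈⟨ times*-partFactorsFrom-double M (times* (odd⁺ ∷ half⁻ ∷ half⁺ ∷ even⁺ ∷ []) f) ⟩
  times* P₂ (times* Φ (times* P (times* (odd⁺ ∷ half⁻ ∷ half⁺ ∷ even⁺ ∷ []) f)))
    ≈⟨ times*-cong P₂ (times*-cong Φ (times*-comm P (odd⁺ ∷ half⁻ ∷ half⁺ ∷ even⁺ ∷ []) f)) ⟩
  times* P₂ (times* Φ (times* (odd⁺ ∷ half⁻ ∷ half⁺ ∷ []) (times even⁺ (times* P f))))
    ≈⟨ times*-cong P₂ (times*-cong Φ (times*-times (odd⁺ ∷ half⁻ ∷ half⁺ ∷ []) even⁺ (times* P f))) ⟩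
  times* P₂ (times* Φ (times* (even⁺ ∷ odd⁺ ∷ half⁻ ∷ []) (times* (half⁺ ∷ P) f)))
    ≈⟨ times*-cong P₂ (times*-comm Φ (even⁺ ∷ odd⁺ ∷ half⁻ ∷ []) _) ⟩
  times* P₂ (times* (even⁺ ∷ odd⁺ ∷ []) (times* (half⁻ ∷ Φ) (times* (half⁺ ∷ P) f)))
    ≈⟨ times*-comm P₂ (even⁺ ∷ odd⁺ ∷ []) _ ⟩
  times* (even⁺ ∷ odd⁺ ∷ P₂) (times* (half⁻ ∷ Φ) (times* (half⁺ ∷ P) f))
    ∎
  where
  open ≗-Reasoning
  K = M ℕ.+ M
  P₂ = factorsUpTo 1ℤ K
  Φ = factorsUpTo -1ℤ M
  P = factorsUpTo 1ℤ M
  even⁺ = (1ℤ , suc (suc K))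
  odd⁺ = (1ℤ , suc K)
  half⁻ = (-1ℤ , suc M)
  half⁺ = (1ℤ , suc M)
  lastTwo : partFactorsFrom K 2 ≡ odd⁺ ∷ (-1ℤ , suc (suc K)) ∷ even⁺ ∷ []
  lastTwo rewrite evenᵇ-double M = refl
  split : partFactorsFrom 0 (suc (suc K)) ≡ partFactorsFrom 0 K ++ odd⁺ ∷ (-1ℤ , suc (suc K)) ∷ even⁺ ∷ []
  split = trans (cong (partFactorsFrom 0) (ℕ.+-comm 2 K)) (trans (partFactorsFrom-+ 0 K 2) (cong (partFactorsFrom 0 K ++_) lastTwo))

partFactorsFrom-coeff : ∀ n → times* (partFactorsFrom 0 n) 1ₛ n ≡ gaussProduct n n
partFactorsFrom-coeff n = begin
  times* (partFactorsFrom 0 n) 1ₛ n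
    ≡⟨ times*-≈ (partFactorsFrom 0 n) (times*-≈-id (partFactorsFrom-above n e)) n ℕ.≤-refl ⟨
  times* (partFactorsFrom 0 n) (times* (partFactorsFrom n e) 1ₛ) n
    ≡⟨ times*-++ (partFactorsFrom 0 n) (partFactorsFrom n e) 1ₛ n ⟨
  times* (partFactorsFrom 0 n ++ partFactorsFrom n e) 1ₛ n
    ≡⟨ cong (λ xs → times* xs 1ₛ n) (partFactorsFrom-+ 0 n e) ⟨
  times* (partFactorsFrom 0 (n ℕ.+ e)) 1ₛ n
    ≡⟨ cong (λ m → times* (partFactorsFrom 0 m) 1ₛ n) n+e≡M+M ⟩
  times* (partFactorsFrom 0 (M ℕ.+ M)) 1ₛ n
    ≡⟨ times*-partFactorsFrom-double M 1ₛ n ⟩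
  times* (factorsUpTo 1ℤ (M ℕ.+ M)) (times* Φ (times* P 1ₛ)) n
    ≡⟨ factorsUpTo-≈ 1ℤ (ℕ.m≤m+n M M) n n≤M ⟩
  times* P (times* Φ (times* P 1ₛ)) n
    ≡⟨ times*-comm P Φ (times* P 1ₛ) n ⟩
  times* Φ (times* P (times* P 1ₛ)) n
    ≡⟨ times*-≈ Φ (times*-≈ P (times-≈-id 1ℤ (ℕ.n<1+n n))) n ℕ.≤-refl ⟩
  gaussProduct n n
    ∎
  where
  open ≡-Reasoning
  M = suc n
  Φ = factorsUpTo -1ℤ M
  P = factorsUpTo 1ℤ M
  e = (M ℕ.+ M) ∸ n
  n≤M = ℕ.n≤1+n n
  n+e≡M+M = ℕ.m+[n∸m]≡n (ℕ.≤-trans n≤M (ℕ.m≤m+n M M))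

∑ℤ : {A : Set} → List A → (A → ℤ) → ℤ
∑ℤ [] h = 0ℤ
∑ℤ (x ∷ xs) h = h x + ∑ℤ xs h

∑ℤ-cong : ∀ (xs : List A) {h h′ : A → ℤ} → (∀ x → h x ≡ h′ x) → ∑ℤ xs h ≡ ∑ℤ xs h′
∑ℤ-cong [] _ = refl
∑ℤ-cong (x ∷ xs) h≗h′ = cong₂ _+_ (h≗h′ x) (∑ℤ-cong xs h≗h′)

∑ℤ-+ : ∀ (xs : List A) (h h′ : A → ℤ) → ∑ℤ xs (λ x → h x + h′ x) ≡ ∑ℤ xs h + ∑ℤ xs h′
∑ℤ-+ [] h h′ = refl
∑ℤ-+ (x ∷ xs) h h′ rewrite ∑ℤ-+ xs h h′ =
  ℤ+.interchange (h x) (h′ x) (∑ℤ xs h) (∑ℤ xs h′)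

∑ℤ-*ˡ : ∀ (xs : List A) c (h : A → ℤ) → ∑ℤ xs (λ x → c * h x) ≡ c * ∑ℤ xs h
∑ℤ-*ˡ [] c h = sym (ℤ.*-zeroʳ c)
∑ℤ-*ˡ (x ∷ xs) c h = trans (cong (c * h x +_) (∑ℤ-*ˡ xs c h)) (sym (ℤ.*-distribˡ-+ c (h x) _))

∑ℤ-0 : ∀ (xs : List A) → ∑ℤ xs (λ _ → 0ℤ) ≡ 0ℤ
∑ℤ-0 [] = refl
∑ℤ-0 (x ∷ xs) = trans (ℤ.+-identityˡ _) (∑ℤ-0 xs)

∑ℤ-++ : ∀ (xs ys : List A) (h : A → ℤ) → ∑ℤ (xs ++ ys) h ≡ ∑ℤ xs h + ∑ℤ ys h
∑ℤ-++ [] ys h = sym (ℤ.+-identityˡ _)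
∑ℤ-++ (x ∷ xs) ys h = trans (cong (h x +_) (∑ℤ-++ xs ys h)) (sym (ℤ.+-assoc (h x) _ _))

∑ℤ-concatMap : ∀ (f : A → List B) (xs : List A) (h : B → ℤ) →
  ∑ℤ (concatMap f xs) h ≡ ∑ℤ xs (λ x → ∑ℤ (f x) h)
∑ℤ-concatMap f [] h = refl
∑ℤ-concatMap f (x ∷ xs) h = trans (∑ℤ-++ (f x) (concatMap f xs) h) (cong (∑ℤ (f x) h +_) (∑ℤ-concatMap f xs h))

∑ℤ-map : ∀ (f : A → B) (xs : List A) (h : B → ℤ) → ∑ℤ (map f xs) h ≡ ∑ℤ xs (h ∘ f)
∑ℤ-map f [] h = refl
∑ℤ-map f (x ∷ xs) h = cong (h (f x) +_) (∑ℤ-map f xs h)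

∑ℤ-filterᵇ : ∀ (P : A → Bool) xs (h : A → ℤ) → ∑ℤ (filterᵇ P xs) h ≡ ∑ℤ xs (λ x → if P x then h x else 0ℤ)
∑ℤ-filterᵇ P [] h = refl
∑ℤ-filterᵇ P (x ∷ xs) h with P x
... | true = cong (h x +_) (∑ℤ-filterᵇ P xs h)
... | false = trans (∑ℤ-filterᵇ P xs h) (sym (ℤ.+-identityˡ _))

∑ℤ-filterᵇ-cong : ∀ (P : A → Bool) xs {h h′ : A → ℤ} → (∀ x → P x ≡ true → h x ≡ h′ x) →
  ∑ℤ (filterᵇ P xs) h ≡ ∑ℤ (filterᵇ P xs) h′
∑ℤ-filterᵇ-cong P [] _ = refl
∑ℤ-filterᵇ-cong P (x ∷ xs) h≗h′ with P x in Px
... | true = cong₂ _+_ (h≗h′ x Px) (∑ℤ-filterᵇ-cong P xs h≗h′)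
... | false = ∑ℤ-filterᵇ-cong P xs h≗h′

length-filterᵇ-difference : ∀ (P : A → Bool) xs →
  ⁺ (length (filterᵇ P xs)) - ⁺ (length (filterᵇ (not ∘ P) xs)) ≡ ∑ℤ xs (λ x → if P x then 1ℤ else -1ℤ)
length-filterᵇ-difference P [] = refl
length-filterᵇ-difference P (x ∷ xs) with P x
... | true = trans (ℤ.+-assoc 1ℤ (⁺ (length (filterᵇ P xs))) (ℤ.- ⁺ (length (filterᵇ (not ∘ P) xs))))
                   (cong (1ℤ +_) (length-filterᵇ-difference P xs))
... | false = trans (solve 2 (λ a b → a :- (con 1ℤ :+ b) := con -1ℤ :+ (a :- b)) refl (⁺ (length (filterᵇ P xs))) (⁺ (length (filterᵇ (not ∘ P) xs))))
                    (cong (-1ℤ +_) (length-filterᵇ-difference P xs))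

∑ᴸ : {A : Set} → List A → (A → Series) → Series
∑ᴸ xs F n = ∑ℤ xs (λ x → F x n)

∑ᴸ-cong : ∀ (xs : List A) {F G : A → Series} → (∀ x → F x ≗ G x) → ∑ᴸ xs F ≗ ∑ᴸ xs G
∑ᴸ-cong xs F≗G n = ∑ℤ-cong xs (λ x → F≗G x n)

∑ᴸ-⊕ : ∀ (xs : List A) (F G : A → Series) → ∑ᴸ xs (λ x → F x ⊕ G x) ≗ ∑ᴸ xs F ⊕ ∑ᴸ xs G
∑ᴸ-⊕ xs F G n = ∑ℤ-+ xs (λ x → F x n) (λ x → G x n)

shift-∑ᴸ : ∀ j (xs : List A) (F : A → Series) → shift j (∑ᴸ xs F) ≗ ∑ᴸ xs (shift j ∘ F)
shift-∑ᴸ zero xs F n = refl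
shift-∑ᴸ (suc j) xs F zero = sym (∑ℤ-0 xs)
shift-∑ᴸ (suc j) xs F (suc n) = shift-∑ᴸ j xs F n

times-∑ᴸ : ∀ x (xs : List A) (F : A → Series) → times x (∑ᴸ xs F) ≗ ∑ᴸ xs (times x ∘ F)
times-∑ᴸ (c , k) xs F n = begin
  ∑ᴸ xs F n + c * shift k (∑ᴸ xs F) n                     ≡⟨ cong (λ z → ∑ᴸ xs F n + c * z) (shift-∑ᴸ k xs F n) ⟩
  ∑ᴸ xs F n + c * ∑ℤ xs (λ y → shift k (F y) n)           ≡⟨ cong (∑ᴸ xs F n +_) (∑ℤ-*ˡ xs c (λ y → shift k (F y) n)) ⟨
  ∑ᴸ xs F n + ∑ℤ xs (λ y → c * shift k (F y) n)           ≡⟨ ∑ℤ-+ xs (λ y → F y n) (λ y → c * shift k (F y) n) ⟨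
  ∑ᴸ xs (times (c , k) ∘ F) n                              ∎
  where open ≡-Reasoning

times*-∑ᴸ : ∀ fs (xs : List A) (F : A → Series) → times* fs (∑ᴸ xs F) ≗ ∑ᴸ xs (times* fs ∘ F)
times*-∑ᴸ [] xs F = ≗.refl
times*-∑ᴸ (x ∷ fs) xs F = ≗.trans (times-cong x (times*-∑ᴸ fs xs F)) (times-∑ᴸ x xs (times* fs ∘ F))

-1^≡if-evenᵇ : ∀ k → -1ℤ ^ k ≡ (if evenᵇ k then 1ℤ else -1ℤ)
-1^≡if-evenᵇ zero = refl
-1^≡if-evenᵇ (suc k) rewrite -1^≡if-evenᵇ k with evenᵇ k
... | true = refl
... | false = refl

-1^-even : ∀ k → evenᵇ k ≡ true → -1ℤ ^ k ≡ 1ℤ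
-1^-even k even[k] = trans (-1^≡if-evenᵇ k) (cong (λ t → if t then 1ℤ else -1ℤ) even[k])

-1^-odd : ∀ k → evenᵇ k ≡ false → -1ℤ ^ k ≡ -1ℤ
-1^-odd k odd[k] = trans (-1^≡if-evenᵇ k) (cong (λ t → if t then 1ℤ else -1ℤ) odd[k])

-1^-length : ∀ xs → -1ℤ ^ length xs ≡ -1ℤ ^ length (filterᵇ evenᵇ xs) * -1ℤ ^ sum xs
-1^-length [] = refl
-1^-length (x ∷ xs) with evenᵇ x in even[x]
... | true = begin
  -1ℤ * -1ℤ ^ length xs             ≡⟨ cong (-1ℤ *_) (-1^-length xs) ⟩
  -1ℤ * (E * S)                     ≡⟨ ℤ.*-assoc -1ℤ E S ⟨
  (-1ℤ * E) * S                     ≡⟨ cong ((-1ℤ * E) *_) (ℤ.*-identityˡ S) ⟨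
  (-1ℤ * E) * (1ℤ * S)              ≡⟨ cong (λ z → (-1ℤ * E) * (z * S)) (-1^-even x even[x]) ⟨
  (-1ℤ * E) * (-1ℤ ^ x * S)         ≡⟨ cong ((-1ℤ * E) *_) (ℤ.^-distribˡ-+-* -1ℤ x (sum xs)) ⟨
  (-1ℤ * E) * -1ℤ ^ (x ℕ.+ sum xs)  ∎
  where
  open ≡-Reasoning
  E = -1ℤ ^ length (filterᵇ evenᵇ xs)
  S = -1ℤ ^ sum xs
... | false = begin
  -1ℤ * -1ℤ ^ length xs             ≡⟨ cong (-1ℤ *_) (-1^-length xs) ⟩
  -1ℤ * (E * S)                     ≡⟨ ℤ*.x∙yz≈y∙xz -1ℤ E S ⟩
  E * (-1ℤ * S)                     ≡⟨ cong (λ z → E * (z * S)) (-1^-odd x even[x]) ⟨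
  E * (-1ℤ ^ x * S)                 ≡⟨ cong (E *_) (ℤ.^-distribˡ-+-* -1ℤ x (sum xs)) ⟨
  E * -1ℤ ^ (x ℕ.+ sum xs)          ∎
  where
  open ≡-Reasoning
  E = -1ℤ ^ length (filterᵇ evenᵇ xs)
  S = -1ℤ ^ sum xs

-1^-sum-allEven : ∀ xs → allᵇ evenᵇ xs ≡ true → -1ℤ ^ sum xs ≡ 1ℤ
-1^-sum-allEven [] _ = refl
-1^-sum-allEven (x ∷ xs) allEven = begin
  -1ℤ ^ (x ℕ.+ sum xs)        ≡⟨ ℤ.^-distribˡ-+-* -1ℤ x (sum xs) ⟩
  -1ℤ ^ x * -1ℤ ^ sum xs      ≡⟨ cong₂ _*_ (-1^-even x (∧-conicalˡ _ _ allEven)) (-1^-sum-allEven xs (∧-conicalʳ _ _ allEven)) ⟩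
  1ℤ                          ∎
  where open ≡-Reasoning

weighted : Bool → ℤ → ℕ → Series
weighted a σ s = if a then σ · q^ s else 0ₛ

weighted-shift : ∀ j a σ s → shift j (weighted a σ s) ≗ weighted a σ (j ℕ.+ s)
weighted-shift j true σ s n = trans (shift-· j σ (q^ s) n) (cong (σ *_) (shift-q^ j s n))
weighted-shift j false σ s n = shift-0ₛ j n

weighted-scale : ∀ c a σ s → c · weighted a σ s ≗ weighted a (c * σ) s
weighted-scale c true σ s n = sym (ℤ.*-assoc c σ _)
weighted-scale c false σ s n = ℤ.*-zeroʳ c

weighted-∧ : ∀ t a σ j s → weighted (t ∧ a) σ (j ℕ.+ s) ≗ (if t then shift j (weighted a σ s) else 0ₛ)
weighted-∧ true a σ j s = ≗.sym (weighted-shift j a σ s)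
weighted-∧ false a σ j s = ≗.refl

weighted-coeff : ∀ a σ s n → weighted a σ s n ≡ (if a ∧ (s ≡ᵇ n) then σ else 0ℤ)
weighted-coeff false σ s n = refl
weighted-coeff true σ s n with s ≡ᵇ n
... | true = ℤ.*-identityʳ σ
... | false = ℤ.*-zeroʳ σ

listWeight : List ℕ → List ℕ → Series
listWeight bs gs = weighted (allᵇ evenᵇ gs) (-1ℤ ^ length (filterᵇ evenᵇ bs)) (sum bs ℕ.+ sum gs)

-1^-length-filterᵇ-∷ : ∀ j xs → -1ℤ ^ length (filterᵇ evenᵇ (j ∷ xs)) ≡ blueSign j * -1ℤ ^ length (filterᵇ evenᵇ xs)
-1^-length-filterᵇ-∷ j xs with evenᵇ j
... | true = refl
... | false = sym (ℤ.*-identityˡ _)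

listWeight-blue : ∀ j bs gs → listWeight (j ∷ bs) gs ≗ blueSign j · shift j (listWeight bs gs)
listWeight-blue j bs gs = begin
  weighted evenGreen (-1ℤ ^ length (filterᵇ evenᵇ (j ∷ bs))) ((j ℕ.+ sum bs) ℕ.+ sum gs)
    ≡⟨ cong₂ (weighted evenGreen) (-1^-length-filterᵇ-∷ j bs) (ℕ.+-assoc j (sum bs) (sum gs)) ⟩
  weighted evenGreen (blueSign j * σ) (j ℕ.+ s)
    ≈⟨ weighted-scale (blueSign j) evenGreen σ (j ℕ.+ s) ⟨
  blueSign j · weighted evenGreen σ (j ℕ.+ s)
    ≈⟨ ·-cong (blueSign j) (weighted-shift j evenGreen σ s) ⟨
  blueSign j · shift j (weighted evenGreen σ s)
    ∎
  where
  open ≗-Reasoning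
  evenGreen = allᵇ evenᵇ gs
  σ = -1ℤ ^ length (filterᵇ evenᵇ bs)
  s = sum bs ℕ.+ sum gs

greenShift : ℕ → Series → Series
greenShift j f = if evenᵇ j then shift j f else 0ₛ

listWeight-green : ∀ j bs gs → listWeight bs (j ∷ gs) ≗ greenShift j (listWeight bs gs)
listWeight-green j bs gs = begin
  weighted (evenᵇ j ∧ evenGreen) σ (sum bs ℕ.+ (j ℕ.+ sum gs))  ≡⟨ cong (weighted (evenᵇ j ∧ evenGreen) σ) (ℕ+.x∙yz≈y∙xz (sum bs) j (sum gs)) ⟩
  weighted (evenᵇ j ∧ evenGreen) σ (j ℕ.+ (sum bs ℕ.+ sum gs))  ≈⟨ weighted-∧ (evenᵇ j) evenGreen σ j (sum bs ℕ.+ sum gs) ⟩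
  greenShift j (listWeight bs gs)                        ∎
  where
  open ≗-Reasoning
  evenGreen = allᵇ evenᵇ gs
  σ = -1ℤ ^ length (filterᵇ evenᵇ bs)

greenShift-⊕ : ∀ j f → greenShift j f ⊕ f ≗ times* (greenFactors j) f
greenShift-⊕ j f = byParity (evenᵇ j)
  where
  byParity : ∀ t → (if t then shift j f else 0ₛ) ⊕ f ≗ times* (if t then (1ℤ , j) ∷ [] else []) f
  byParity true n = trans (ℤ.+-comm (shift j f n) (f n)) (cong (f n +_) (sym (ℤ.*-identityˡ _)))
  byParity false n = ℤ.+-identityˡ (f n)

weight : ℕ → Vec Bool m → Vec Bool m → Series
weight k b g = listWeight (partsFrom k b) (partsFrom k g)

weight-∷ : ∀ k (v w : Vec Bool m) →
  (weight k (true ∷ v) (true ∷ w) ⊕ weight k (true ∷ v) (false ∷ w))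
    ⊕ (weight k (false ∷ v) (true ∷ w) ⊕ weight k (false ∷ v) (false ∷ w))
  ≗ times* (partFactors (suc k)) (weight (suc k) v w)
weight-∷ k v w = begin
  (listWeight (j ∷ bs) (j ∷ gs) ⊕ listWeight (j ∷ bs) gs) ⊕ (listWeight bs (j ∷ gs) ⊕ X)
    ≈⟨ ⊕-cong (⊕-cong (listWeight-blue j bs (j ∷ gs)) (listWeight-blue j bs gs)) (⊕-congʳ X (listWeight-green j bs gs)) ⟩
  (s · shift j (listWeight bs (j ∷ gs)) ⊕ s · shift j X) ⊕ (Y ⊕ X)
    ≈⟨ ⊕-congʳ (Y ⊕ X) (⊕-congʳ (s · shift j X) (·-cong s (shift-cong j (listWeight-green j bs gs)))) ⟩
  (s · shift j Y ⊕ s · shift j X) ⊕ (Y ⊕ X)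
    ≈⟨ ⊕-congʳ (Y ⊕ X) (≗.trans (·-cong s (shift-⊕ j Y X)) (·-⊕ s (shift j Y) (shift j X))) ⟨
  s · shift j (Y ⊕ X) ⊕ (Y ⊕ X)
    ≈⟨ ⊕-comm (s · shift j (Y ⊕ X)) (Y ⊕ X) ⟩
  times (s , j) (Y ⊕ X)
    ≈⟨ times-cong (s , j) (greenShift-⊕ j X) ⟩
  times* (partFactors j) X
    ∎
  where
  open ≗-Reasoning
  j = suc k
  s = blueSign j
  bs = partsFrom j v
  gs = partsFrom j w
  X = listWeight bs gs
  Y = greenShift j X

signedCount : ℕ → ℕ → Series
signedCount k m = ∑ᴸ (allBits m) (λ b → ∑ᴸ (allBits m) (weight k b))

∑ᴸ-allBits-suc : ∀ m (F : Vec Bool (suc m) → Series) →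
  ∑ᴸ (allBits (suc m)) F ≗ ∑ᴸ (allBits m) (λ v → F (true ∷ v) ⊕ F (false ∷ v))
∑ᴸ-allBits-suc m F n = trans (∑ℤ-concatMap (λ v → (true ∷ v) ∷ (false ∷ v) ∷ []) (allBits m) (λ b → F b n))
  (∑ℤ-cong (allBits m) (λ v → cong (F (true ∷ v) n +_) (ℤ.+-identityʳ (F (false ∷ v) n))))

signedCount-suc : ∀ k m → signedCount k (suc m) ≗ times* (partFactors (suc k)) (signedCount (suc k) m)
signedCount-suc k m = begin
  ∑ᴸ (allBits (suc m)) (λ b → ∑ᴸ (allBits (suc m)) (weight k b))
    ≈⟨ ∑ᴸ-allBits-suc m _ ⟩
  ∑ᴸ bits (λ v → ∑ᴸ (allBits (suc m)) (weight k (true ∷ v)) ⊕ ∑ᴸ (allBits (suc m)) (weight k (false ∷ v)))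
    ≈⟨ ∑ᴸ-cong bits (λ v → ⊕-cong (∑ᴸ-allBits-suc m _) (∑ᴸ-allBits-suc m _)) ⟩
  ∑ᴸ bits (λ v → ∑ᴸ bits (λ w → weight k (true ∷ v) (true ∷ w) ⊕ weight k (true ∷ v) (false ∷ w))
                 ⊕ ∑ᴸ bits (λ w → weight k (false ∷ v) (true ∷ w) ⊕ weight k (false ∷ v) (false ∷ w)))
    ≈⟨ ∑ᴸ-cong bits (λ v → ∑ᴸ-⊕ bits _ _) ⟨
  ∑ᴸ bits (λ v → ∑ᴸ bits (λ w → (weight k (true ∷ v) (true ∷ w) ⊕ weight k (true ∷ v) (false ∷ w))
                                ⊕ (weight k (false ∷ v) (true ∷ w) ⊕ weight k (false ∷ v) (false ∷ w))))
    ≈⟨ ∑ᴸ-cong bits (λ v → ∑ᴸ-cong bits (weight-∷ k v)) ⟩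
  ∑ᴸ bits (λ v → ∑ᴸ bits (times* (partFactors (suc k)) ∘ weight (suc k) v))
    ≈⟨ ∑ᴸ-cong bits (λ v → times*-∑ᴸ (partFactors (suc k)) bits (weight (suc k) v)) ⟨
  ∑ᴸ bits (λ v → times* (partFactors (suc k)) (∑ᴸ bits (weight (suc k) v)))
    ≈⟨ times*-∑ᴸ (partFactors (suc k)) bits _ ⟨
  times* (partFactors (suc k)) (signedCount (suc k) m)
    ∎
  where
  open ≗-Reasoning
  bits = allBits m

signedCount-product : ∀ m k → signedCount k m ≗ times* (partFactorsFrom k m) 1ₛ
signedCount-product zero k n = trans (ℤ.+-identityʳ _) (trans (ℤ.+-identityʳ _) (ℤ.*-identityˡ _))
signedCount-product (suc m) k = begin
  signedCount k (suc m)                                                   ≈⟨ signedCount-suc k m ⟩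
  times* (partFactors (suc k)) (signedCount (suc k) m)                    ≈⟨ times*-cong (partFactors (suc k)) (signedCount-product m (suc k)) ⟩
  times* (partFactors (suc k)) (times* (partFactorsFrom (suc k) m) 1ₛ)    ≈⟨ times*-++ (partFactors (suc k)) (partFactorsFrom (suc k) m) 1ₛ ⟨
  times* (partFactorsFrom k (suc m)) 1ₛ                                   ∎
  where open ≗-Reasoning

isLPartition-weight : ∀ n (b g : Vec Bool n) →
  (if isLPartition n (b , g) then (if evenᵇ (blueEvenCount (b , g)) then 1ℤ else -1ℤ) else 0ℤ) ≡ weight 0 b g n
isLPartition-weight n b g = begin
  (if isLPartition n (b , g) then (if evenᵇ (blueEvenCount (b , g)) then 1ℤ else -1ℤ) else 0ℤ)
    ≡⟨ cong (λ σ → if isLPartition n (b , g) then σ else 0ℤ) (-1^≡if-evenᵇ (blueEvenCount (b , g))) ⟨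
  (if isLPartition n (b , g) then -1ℤ ^ blueEvenCount (b , g) else 0ℤ)
    ≡⟨ weighted-coeff (allᵇ evenᵇ (parts g)) _ (sum (parts b) ℕ.+ sum (parts g)) n ⟨
  weight 0 b g n
    ∎
  where open ≡-Reasoning

L₀-L₁≡signedCount : ∀ n → ⁺ (L₀ n) - ⁺ (L₁ n) ≡ signedCount 0 n n
L₀-L₁≡signedCount n = begin
  ⁺ (L₀ n) - ⁺ (L₁ n)
    ≡⟨ length-filterᵇ-difference P (LPartitions n) ⟩
  ∑ℤ (LPartitions n) sgn
    ≡⟨ ∑ℤ-filterᵇ (isLPartition n) (allPairs n) sgn ⟩
  ∑ℤ (allPairs n) term
    ≡⟨ ∑ℤ-concatMap (λ b → map (b ,_) (allBits n)) (allBits n) term ⟩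
  ∑ℤ (allBits n) (λ b → ∑ℤ (map (b ,_) (allBits n)) term)
    ≡⟨ ∑ℤ-cong (allBits n) (λ b → ∑ℤ-map (b ,_) (allBits n) term) ⟩
  ∑ℤ (allBits n) (λ b → ∑ℤ (allBits n) (λ g → term (b , g)))
    ≡⟨ ∑ℤ-cong (allBits n) (λ b → ∑ℤ-cong (allBits n) (isLPartition-weight n b)) ⟩
  signedCount 0 n n
    ∎
  where
  open ≡-Reasoning
  P = λ (p : Vec Bool n × Vec Bool n) → evenᵇ (blueEvenCount p)
  sgn = λ (p : Vec Bool n × Vec Bool n) → if P p then 1ℤ else -1ℤ
  term = λ p → if isLPartition n p then sgn p else 0ℤ

blueCount-parity : ∀ n (p : Vec Bool n × Vec Bool n) → isLPartition n p ≡ true →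
  (if evenᵇ (blueCount p) then 1ℤ else -1ℤ) ≡ -1ℤ ^ n * (if evenᵇ (blueEvenCount p) then 1ℤ else -1ℤ)
blueCount-parity n (b , g) isL = begin
  (if evenᵇ (length bs) then 1ℤ else -1ℤ)           ≡⟨ -1^≡if-evenᵇ (length bs) ⟨
  -1ℤ ^ length bs                                    ≡⟨ -1^-length bs ⟩
  -1ℤ ^ blueEvenCount (b , g) * -1ℤ ^ sum bs         ≡⟨ cong (-1ℤ ^ blueEvenCount (b , g) *_) -1^sum[bs]≡-1^n ⟩
  -1ℤ ^ blueEvenCount (b , g) * -1ℤ ^ n              ≡⟨ ℤ.*-comm (-1ℤ ^ blueEvenCount (b , g)) (-1ℤ ^ n) ⟩
  -1ℤ ^ n * -1ℤ ^ blueEvenCount (b , g)              ≡⟨ cong (-1ℤ ^ n *_) (-1^≡if-evenᵇ (blueEvenCount (b , g))) ⟩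
  -1ℤ ^ n * (if evenᵇ (blueEvenCount (b , g)) then 1ℤ else -1ℤ) ∎
  where
  open ≡-Reasoning
  bs = parts b
  gs = parts g
  sum≡n : sum bs ℕ.+ sum gs ≡ n
  sum≡n = ℕ.≡ᵇ⇒≡ _ n (Equivalence.from T-≡ (∧-conicalʳ _ _ isL))
  -1^sum[bs]≡-1^n : -1ℤ ^ sum bs ≡ -1ℤ ^ n
  -1^sum[bs]≡-1^n = begin
    -1ℤ ^ sum bs                        ≡⟨ ℤ.*-identityʳ _ ⟨
    -1ℤ ^ sum bs * 1ℤ                   ≡⟨ cong (-1ℤ ^ sum bs *_) (-1^-sum-allEven gs (∧-conicalˡ _ _ isL)) ⟨
    -1ℤ ^ sum bs * -1ℤ ^ sum gs         ≡⟨ ℤ.^-distribˡ-+-* -1ℤ (sum bs) (sum gs) ⟨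
    -1ℤ ^ (sum bs ℕ.+ sum gs)           ≡⟨ cong (-1ℤ ^_) sum≡n ⟩
    -1ℤ ^ n                             ∎

L₂-L₃≡-1^n*[L₀-L₁] : ∀ n → ⁺ (L₂ n) - ⁺ (L₃ n) ≡ -1ℤ ^ n * (⁺ (L₀ n) - ⁺ (L₁ n))
L₂-L₃≡-1^n*[L₀-L₁] n = begin
  ⁺ (L₂ n) - ⁺ (L₃ n)
    ≡⟨ length-filterᵇ-difference (λ p → evenᵇ (blueCount p)) (LPartitions n) ⟩
  ∑ℤ (LPartitions n) (λ p → if evenᵇ (blueCount p) then 1ℤ else -1ℤ)
    ≡⟨ ∑ℤ-filterᵇ-cong (isLPartition n) (allPairs n) (blueCount-parity n) ⟩
  ∑ℤ (LPartitions n) (λ p → -1ℤ ^ n * (if evenᵇ (blueEvenCount p) then 1ℤ else -1ℤ))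
    ≡⟨ ∑ℤ-*ˡ (LPartitions n) (-1ℤ ^ n) _ ⟩
  -1ℤ ^ n * ∑ℤ (LPartitions n) (λ p → if evenᵇ (blueEvenCount p) then 1ℤ else -1ℤ)
    ≡⟨ cong (-1ℤ ^ n *_) (length-filterᵇ-difference (λ p → evenᵇ (blueEvenCount p)) (LPartitions n)) ⟨
  -1ℤ ^ n * (⁺ (L₀ n) - ⁺ (L₁ n))
    ∎
  where open ≡-Reasoning

theorem1p7 : (n : ℕ) →
    ((Triangular n → ⁺ (L₀ n) - ⁺ (L₁ n) ≡ 1ℤ) × (¬ Triangular n → ⁺ (L₀ n) - ⁺ (L₁ n) ≡ 0ℤ))
    × ((Triangular n → ⁺ (L₂ n) - ⁺ (L₃ n) ≡ -1ℤ ^ n) × (¬ Triangular n → ⁺ (L₂ n) - ⁺ (L₃ n) ≡ 0ℤ))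
theorem1p7 n = (L₀-L₁≡1 , L₀-L₁≡0) , (L₂-L₃≡±1 , L₂-L₃≡0)
  where
  L₀-L₁≡gaussProduct : ⁺ (L₀ n) - ⁺ (L₁ n) ≡ gaussProduct n n
  L₀-L₁≡gaussProduct = trans (L₀-L₁≡signedCount n)
                         (trans (signedCount-product n 0 n) (partFactorsFrom-coeff n))
  L₀-L₁≡1 : Triangular n → ⁺ (L₀ n) - ⁺ (L₁ n) ≡ 1ℤ
  L₀-L₁≡1 Δn = trans L₀-L₁≡gaussProduct (proj₁ (gaussProduct-coeff (ℕ.≤-refl {n})) Δn)
  L₀-L₁≡0 : ¬ Triangular n → ⁺ (L₀ n) - ⁺ (L₁ n) ≡ 0ℤ
  L₀-L₁≡0 ¬Δn = trans L₀-L₁≡gaussProduct (proj₂ (gaussProduct-coeff (ℕ.≤-refl {n})) ¬Δn)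
  L₂-L₃≡±1 : Triangular n → ⁺ (L₂ n) - ⁺ (L₃ n) ≡ -1ℤ ^ n
  L₂-L₃≡±1 Δn = trans (L₂-L₃≡-1^n*[L₀-L₁] n) (trans (cong (-1ℤ ^ n *_) (L₀-L₁≡1 Δn)) (ℤ.*-identityʳ _))
  L₂-L₃≡0 : ¬ Triangular n → ⁺ (L₂ n) - ⁺ (L₃ n) ≡ 0ℤ
  L₂-L₃≡0 ¬Δn = trans (L₂-L₃≡-1^n*[L₀-L₁] n) (trans (cong (-1ℤ ^ n *_) (L₀-L₁≡0 ¬Δn)) (ℤ.*-zeroʳ (-1ℤ ^ n)))
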